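{- Let $A,B\in\mathbb Z$ and $\Delta=A^2-4B$. Let $p$ be an odd prime and let $m\in\mathbb Z$ with $p\nmid m$. Suppose that $p\nmid\Delta$ and $d^2\equiv m^2-4Am+16B\not\equiv0\pmod p$ where $d\in\mathbb Z$. Then $$\sum_{k=0}^{p-1}\frac{u_k(A,B)}{m^k}\binom{2k}k\equiv\begin{cases}0\pmod p&\text{if }(\frac{\Delta}p)=1,\\ -\frac 4d(\frac{2m}p)(\frac{m-d-2A}p)\pmod p&\text{if }(\frac{\Delta}p)=-1,\end{cases}$$ and $$\sum_{k=0}^{p-1}\frac{v_k(A,B)}{m^k}\binom{2k}k\equiv\begin{cases}2(\frac{2m}p)(\frac{m-d-2A}p)\pmod p&\text{if }(\frac{\Delta}p)=1,\\ \frac {4A-2m}d(\frac{2m}p)(\frac{m-d-2A}p)\pmod p&\text{if }(\frac{\Delta}p)=-1.\end{cases}$$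
   Context: For $A,B\in\mathbb Z$ the Lucas sequences are defined by $u_0=0$, $u_1=1$, $u_{n+1}=Au_n-Bu_{n-1}$ and $v_0=2$, $v_1=A$, $v_{n+1}=Av_n-Bv_{n-1}$ ($n\ge1$); we write $u_n(A,B)$, $v_n(A,B)$. $\left(\frac{\cdot}{p}\right)$ is the Legendre symbol. Congruences between rationals with denominators prime to $p$ are understood in the ring of such rationals (so e.g. $\frac4d$ means $4$ times the inverse of $d$ modulo $p$). -}

module Defs where

open import Data.Nat as ℕ using (ℕ; zero; suc)
open import Data.Nat.Combinatorics using (_C_)
open import Data.Integer using (ℤ; +_; -_; _+_; _-_; _*_; _^_; ∣_∣; 0ℤ; 1ℤ)
open import Data.Integer.Divisibility using (_∣_)
open import Data.Product using (_×_; _,_; proj₁; proj₂)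
open import Data.List using (List; upTo; map)
open import Data.List.Relation.Unary.Any using (any?)
open import Data.Bool using (Bool; true; false; if_then_else_)
open import Relation.Nullary.Decidable using (does)
import Data.Nat.Divisibility as ℕD

private
  step : ℤ → ℤ → ℤ × ℤ → ℤ × ℤ
  step A B (x , y) = (y , A * y - B * x)

  iter : ℕ → (ℤ × ℤ → ℤ × ℤ) → ℤ × ℤ → ℤ × ℤ
  iter zero f s = s
  iter (suc n) f s = iter n f (f s)

u : ℤ → ℤ → ℕ → ℤ
u A B n = proj₁ (iter n (step A B) (0ℤ , 1ℤ))

v : ℤ → ℤ → ℕ → ℤ
v A B n = proj₁ (iter n (step A B) (+ 2 , A))

legendre : ℤ → ℕ → ℤ
legendre a p =
  if does (p ℕD.∣? ∣ a ∣) then 0ℤ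
  else if does (any? (λ x → p ℕD.∣? ∣ (+ x) * (+ x) - a ∣) (upTo p)) then 1ℤ
  else - 1ℤ

-- Rationals with denominators prime to p, represented as (numerator , denominator).
Frac : Set
Frac = ℤ × ℤ

_⊕_ : Frac → Frac → Frac
(a , b) ⊕ (c , e) = (a * e + c * b , b * e)

sumFrac : ℕ → (ℕ → Frac) → Frac
sumFrac zero f = (0ℤ , 1ℤ)
sumFrac (suc n) f = sumFrac n f ⊕ f n

_≡_[modQ_] : Frac → Frac → ℕ → Set
(a , b) ≡ (c , e) [modQ p ] = (+ p) ∣ (a * e - c * b)

lucasSum : (ℕ → ℤ) → ℤ → ℕ → Frac
lucasSum w m p = sumFrac p (λ k → (w k * + ((2 ℕ.* k) C k) , m ^ k))

{-# OPTIONS --safe #-}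

-- Work in R = (ℤ/p)[α] with α² = Aα - B. There α^k = κ_k + u_k α with v_k = 2κ_k + A u_k, so both
-- sums are read off the coordinates of T = Σ_{k<p} C(2k,k) (α/m)^k. For p = 2n + 1 one has
-- C(2k,k) ≡ (-4)^k C(n,k), hence T = (1 - 4α/m)ⁿ. Put t = m - d - 2A and w = (m - d) - 4α; then
-- w² = 2mt (1 - 4α/m) and, by Euler's criterion, w^p = w (w²)ⁿ = ε w T. On the other hand
-- w^p = (m - d) - 4α^p by Frobenius, and α^p is α or its conjugate A - α according as (Δ/p) = 1 or -1.
-- Multiplying by w̄ = (m - d - 4A) + 4α, for which w w̄ = -2dt, gives T = ε in the first case and
-- -2dt ε T = w̄² in the second; the four congruences follow.

module Submission where

open import Level using (0ℓ)
open import Algebra.Bundles using (CommutativeRing)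
open import Algebra.Definitions using (Congruent₁; Congruent₂)
open import Data.Bool using (if_then_else_)
open import Data.Empty using (⊥-elim)
open import Data.Fin using (toℕ)
open import Data.List using (upTo)
open import Data.List.Relation.Unary.Any using (Any; any?; satisfied)
open import Data.List.Relation.Unary.Any.Properties using (applyUpTo⁺)
open import Data.Nat as ℕ using (ℕ; zero; suc; _∸_; _<_; _≤_; s≤s; z≤n)
import Data.Nat.Properties as ℕP
import Data.Nat.Divisibility as ℕD
open import Data.Nat.Combinatorics using (_C_; nCn≡1; k>n⇒nCk≡0)
open import Data.Nat.Primality using (Prime; prime⇒nonZero; prime⇒nonTrivial; prime⇒irreducible; euclidsLemma)
open import Data.Product using (Σ-syntax; _×_; _,_; proj₁; proj₂)
open import Data.Sum as Sum using (_⊎_; inj₁; inj₂; [_,_]′)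
open import Function using (_∘_)
open import Relation.Binary.Core using (Rel; _⇒_)
open import Relation.Binary.Structures using (IsEquivalence)
open import Relation.Nullary using (¬_; Dec; yes; no; does)
open import Relation.Binary.PropositionalEquality as ≡ using (_≡_; _≢_)
import Relation.Binary.Reasoning.Setoid
open import Defs

coarsenRing : (R : CommutativeRing 0ℓ 0ℓ) → let open CommutativeRing R in
  (_~_ : Rel Carrier 0ℓ) → IsEquivalence _~_ → _≈_ ⇒ _~_ →
  Congruent₂ _~_ _+_ → Congruent₂ _~_ _*_ → Congruent₁ _~_ (-_) → CommutativeRing 0ℓ 0ℓ
coarsenRing R _~_ isEq ≈⇒~ +-cong~ *-cong~ -‿cong~ = record
  { Carrier = Carrier ; _≈_ = _~_ ; _+_ = _+_ ; _*_ = _*_ ; -_ = -_ ; 0# = 0# ; 1# = 1#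
  ; isCommutativeRing = record
    { isRing = record
      { +-isAbelianGroup = record
        { isGroup = record
          { isMonoid = record
            { isSemigroup = record
              { isMagma = record { isEquivalence = isEq ; ∙-cong = +-cong~ }
              ; assoc = λ x y z → ≈⇒~ (+-assoc x y z) }
            ; identity = (λ x → ≈⇒~ (+-identityˡ x)) , (λ x → ≈⇒~ (+-identityʳ x)) }
          ; inverse = (λ x → ≈⇒~ (-‿inverseˡ x)) , (λ x → ≈⇒~ (-‿inverseʳ x))
          ; ⁻¹-cong = -‿cong~ }
        ; comm = λ x y → ≈⇒~ (+-comm x y) }
      ; *-cong = *-cong~
      ; *-assoc = λ x y z → ≈⇒~ (*-assoc x y z)
      ; *-identity = (λ x → ≈⇒~ (*-identityˡ x)) , (λ x → ≈⇒~ (*-identityʳ x))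
      ; distrib = (λ x y z → ≈⇒~ (distribˡ x y z)) , (λ x y z → ≈⇒~ (distribʳ x y z)) }
    ; *-comm = λ x y → ≈⇒~ (*-comm x y) } }
  where open CommutativeRing R

module BinomialCoefficients where

  open import Data.Nat
  open import Data.Nat.Properties
  open import Data.Nat.Combinatorics using (_C_; nC1≡n; nCk+nC[k+1]≡[n+1]C[k+1])
  open import Data.Nat.Combinatorics.Specification using (k>n⇒nCk≡0)
  open import Data.Nat.Divisibility using (_∣_; m∣m*n; ∣⇒≤)
  open import Data.Nat.Primality using (Prime; euclidsLemma)
  open import Data.Nat.Tactic.RingSolver using (solve-∀)
  open import Data.Sum using (inj₁; inj₂)
  open import Data.Empty using (⊥-elim)
  open import Relation.Binary.PropositionalEquality
  open ≡-Reasoning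

  pascal : ∀ n k → suc n C suc k ≡ n C k + n C suc k
  pascal n k = sym (nCk+nC[k+1]≡[n+1]C[k+1] n k)

  [k+1]*[n+1]C[k+1]≡[n+1]*nCk : ∀ n k → suc k * (suc n C suc k) ≡ suc n * (n C k)
  [k+1]*[n+1]C[k+1]≡[n+1]*nCk zero zero = refl
  [k+1]*[n+1]C[k+1]≡[n+1]*nCk zero (suc k) = begin
    suc (suc k) * (1 C suc (suc k)) ≡⟨ cong (suc (suc k) *_) (k>n⇒nCk≡0 {1} {suc (suc k)} (s≤s (s≤s z≤n))) ⟩
    suc (suc k) * 0                 ≡⟨ *-zeroʳ (suc (suc k)) ⟩
    0                               ≡⟨ cong (1 *_) (k>n⇒nCk≡0 {0} {suc k} (s≤s z≤n)) ⟨
    1 * (0 C suc k)                 ∎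
  [k+1]*[n+1]C[k+1]≡[n+1]*nCk (suc n) zero =
    trans (+-identityʳ _) (trans (nC1≡n (suc (suc n))) (sym (*-identityʳ (suc (suc n)))))
  [k+1]*[n+1]C[k+1]≡[n+1]*nCk (suc n) (suc k) = begin
    suc (suc k) * (suc (suc n) C suc (suc k))
      ≡⟨ cong (suc (suc k) *_) (pascal (suc n) (suc k)) ⟩
    suc (suc k) * (a + b)
      ≡⟨ expand k a b ⟩
    suc k * a + a + suc (suc k) * b
      ≡⟨ cong₂ (λ x y → x + a + y) ([k+1]*[n+1]C[k+1]≡[n+1]*nCk n k) ([k+1]*[n+1]C[k+1]≡[n+1]*nCk n (suc k)) ⟩
    suc n * (n C k) + a + suc n * (n C suc k)
      ≡⟨ cong (λ z → suc n * (n C k) + z + suc n * (n C suc k)) (pascal n k) ⟩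
    suc n * (n C k) + (n C k + n C suc k) + suc n * (n C suc k)
      ≡⟨ collect n (n C k) (n C suc k) ⟩
    suc (suc n) * (n C k + n C suc k)
      ≡⟨ cong (suc (suc n) *_) (pascal n k) ⟨
    suc (suc n) * a ∎
    where
    a = suc n C suc k
    b = suc n C suc (suc k)
    expand : ∀ k a b → suc (suc k) * (a + b) ≡ suc k * a + a + suc (suc k) * b
    expand = solve-∀
    collect : ∀ n x y → suc n * x + (x + y) + suc n * y ≡ suc (suc n) * (x + y)
    collect = solve-∀

  prime⇒p∣pCk : ∀ {p} → Prime p → ∀ {k} → 0 < k → k < p → p ∣ p C k
  prime⇒p∣pCk {suc n} pr {suc k} _ k<p
    with euclidsLemma (suc k) (suc n C suc k) pr
           (subst (suc n ∣_) (sym ([k+1]*[n+1]C[k+1]≡[n+1]*nCk n k)) (m∣m*n (n C k)))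
  ... | inj₁ p∣k+1 = ⊥-elim (<⇒≱ k<p (∣⇒≤ p∣k+1))
  ... | inj₂ p∣pCk = p∣pCk

  [k+1]*nC[k+1]+k*nCk≡n*nCk : ∀ n k → suc k * (n C suc k) + k * (n C k) ≡ n * (n C k)
  [k+1]*nC[k+1]+k*nCk≡n*nCk zero zero = refl
  [k+1]*nC[k+1]+k*nCk≡n*nCk zero (suc k) = begin
    suc (suc k) * (0 C suc (suc k)) + suc k * (0 C suc k)
      ≡⟨ cong₂ (λ x y → suc (suc k) * x + suc k * y) (k>n⇒nCk≡0 {0} {suc (suc k)} (s≤s z≤n)) (k>n⇒nCk≡0 {0} {suc k} (s≤s z≤n)) ⟩
    suc (suc k) * 0 + suc k * 0
      ≡⟨ cong₂ _+_ (*-zeroʳ (suc (suc k))) (*-zeroʳ (suc k)) ⟩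
    0 ∎
  [k+1]*nC[k+1]+k*nCk≡n*nCk (suc n) zero =
    trans (+-identityʳ _) (trans (+-identityʳ _) (trans (nC1≡n (suc n)) (sym (*-identityʳ (suc n)))))
  [k+1]*nC[k+1]+k*nCk≡n*nCk (suc n) (suc k) = begin
    suc (suc k) * (suc n C suc (suc k)) + suc k * (suc n C suc k)
      ≡⟨ cong₂ _+_ ([k+1]*[n+1]C[k+1]≡[n+1]*nCk n (suc k)) ([k+1]*[n+1]C[k+1]≡[n+1]*nCk n k) ⟩
    suc n * (n C suc k) + suc n * (n C k)
      ≡⟨ factor (suc n) (n C suc k) (n C k) ⟩
    suc n * (n C k + n C suc k)
      ≡⟨ cong (suc n *_) (pascal n k) ⟨
    suc n * (suc n C suc k) ∎
    where
    factor : ∀ n x y → n * x + n * y ≡ n * (y + x)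
    factor = solve-∀

  [k+1]*[2k+2]C[k+1]≡2*[2k+1]*[2k]Ck : ∀ k → suc k * ((2 * suc k) C suc k) ≡ 2 * suc (2 * k) * ((2 * k) C k)
  [k+1]*[2k+2]C[k+1]≡2*[2k+1]*[2k]Ck k = begin
    suc k * ((2 * suc k) C suc k)
      ≡⟨ cong (λ z → suc k * (z C suc k)) (double-suc k) ⟩
    suc k * (suc (suc (2 * k)) C suc k)
      ≡⟨ [k+1]*[n+1]C[k+1]≡[n+1]*nCk (suc (2 * k)) k ⟩
    suc (suc (2 * k)) * (suc (2 * k) C k)
      ≡⟨ halve k (suc (2 * k) C k) ⟩
    2 * (suc k * (suc (2 * k) C k))
      ≡⟨ cong (2 *_) (middle-symmetry (suc (2 * k) C suc k) (suc (2 * k) C k)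
                       ([k+1]*nC[k+1]+k*nCk≡n*nCk (suc (2 * k)) k)) ⟨
    2 * (suc k * (suc (2 * k) C suc k))
      ≡⟨ cong (2 *_) ([k+1]*[n+1]C[k+1]≡[n+1]*nCk (2 * k) k) ⟩
    2 * (suc (2 * k) * ((2 * k) C k))
      ≡⟨ *-assoc 2 (suc (2 * k)) _ ⟨
    2 * suc (2 * k) * ((2 * k) C k) ∎
    where
    split-odd : ∀ k y → suc (2 * k) * y ≡ suc k * y + k * y
    split-odd = solve-∀
    middle-symmetry : ∀ x y → suc k * x + k * y ≡ suc (2 * k) * y → suc k * x ≡ suc k * y
    middle-symmetry x y e = +-cancelʳ-≡ (k * y) (suc k * x) (suc k * y)
      (trans e (split-odd k y))
    double-suc : ∀ k → 2 * suc k ≡ suc (suc (2 * k))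
    double-suc = solve-∀
    halve : ∀ k x → suc (suc (2 * k)) * x ≡ 2 * (suc k * x)
    halve = solve-∀

open BinomialCoefficients

module RingSums (R : CommutativeRing 0ℓ 0ℓ) where
  open CommutativeRing R
  open import Algebra.Properties.Semiring.Exp semiring public
  open import Algebra.Properties.Semiring.Mult semiring public renaming (_×_ to _·_)
  open import Algebra.Properties.CommutativeSemiring.Exp commutativeSemiring public
    using (^-distrib-*)
  import Algebra.Properties.CommutativeSemiring.Binomial commutativeSemiring as Binomial
  open import Algebra.Definitions.RawMonoid +-rawMonoid using (sum)
  open import Relation.Binary.Reasoning.Setoid setoid

  Σ : ℕ → (ℕ → Carrier) → Carrier
  Σ zero    f = 0#
  Σ (suc n) f = f 0 + Σ n (λ k → f (suc k))

  Σ-cong : ∀ n {f g : ℕ → Carrier} → (∀ k → k < n → f k ≈ g k) → Σ n f ≈ Σ n g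
  Σ-cong zero    f≈g = refl
  Σ-cong (suc n) f≈g = +-cong (f≈g 0 (s≤s z≤n)) (Σ-cong n (λ k k<n → f≈g (suc k) (s≤s k<n)))

  Σ-≈0 : ∀ n {f : ℕ → Carrier} → (∀ k → k < n → f k ≈ 0#) → Σ n f ≈ 0#
  Σ-≈0 n f≈0 = trans (Σ-cong n f≈0) (Σ-0# n)
    where
    Σ-0# : ∀ n → Σ n (λ _ → 0#) ≈ 0#
    Σ-0# zero    = refl
    Σ-0# (suc n) = trans (+-identityˡ _) (Σ-0# n)

  Σ-last : ∀ n (f : ℕ → Carrier) → Σ (suc n) f ≈ Σ n f + f n
  Σ-last zero    f = trans (+-identityʳ (f 0)) (sym (+-identityˡ (f 0)))
  Σ-last (suc n) f = trans (+-congˡ (Σ-last n (λ k → f (suc k)))) (sym (+-assoc _ _ _))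

  Σ-split : ∀ a b (f : ℕ → Carrier) → Σ (a ℕ.+ b) f ≈ Σ a f + Σ b (λ k → f (a ℕ.+ k))
  Σ-split zero    b f = sym (+-identityˡ _)
  Σ-split (suc a) b f = trans (+-congˡ (Σ-split a b (λ k → f (suc k)))) (sym (+-assoc _ _ _))

  Σ-distrib-+ : ∀ n (f g : ℕ → Carrier) → Σ n (λ k → f k + g k) ≈ Σ n f + Σ n g
  Σ-distrib-+ zero    f g = sym (+-identityʳ 0#)
  Σ-distrib-+ (suc n) f g = trans (+-congˡ (Σ-distrib-+ n (λ k → f (suc k)) (λ k → g (suc k))))
    (sym (interchange (f 0) (Σ n (λ k → f (suc k))) (g 0) (Σ n (λ k → g (suc k)))))
    where open import Algebra.Properties.CommutativeSemigroup +-commutativeSemigroup using (interchange)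

  *-distribˡ-Σ : ∀ n x (f : ℕ → Carrier) → x * Σ n f ≈ Σ n (λ k → x * f k)
  *-distribˡ-Σ zero    x f = zeroʳ x
  *-distribˡ-Σ (suc n) x f = trans (distribˡ x _ _) (+-congˡ (*-distribˡ-Σ n x (λ k → f (suc k))))

  binomial-theorem : ∀ n x y → (x + y) ^ n ≈ Σ (suc n) (λ k → (n C k) · (x ^ k * y ^ (n ∸ k)))
  binomial-theorem n x y = trans (Binomial.theorem n x y) (reflexive (sum≡Σ (suc n) (λ k → (n C k) · (x ^ k * y ^ (n ∸ k)))))
    where
    sum≡Σ : ∀ n (f : ℕ → Carrier) → sum {n} (λ i → f (toℕ i)) ≡ Σ n f
    sum≡Σ zero    f = ≡.refl
    sum≡Σ (suc n) f = ≡.cong (f 0 +_) (sum≡Σ n (λ k → f (suc k)))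

  ^-odd : ∀ x n → x ^ suc (2 ℕ.* n) ≈ x * (x * x) ^ n
  ^-odd x n = *-congˡ (begin
    x ^ (n ℕ.+ (n ℕ.+ 0)) ≡⟨ ≡.cong (x ^_) (≡.cong (n ℕ.+_) (ℕP.+-identityʳ n)) ⟩
    x ^ (n ℕ.+ n)         ≈⟨ ^-homo-* x n n ⟩
    x ^ n * x ^ n         ≈⟨ ^-distrib-* x x n ⟨
    (x * x) ^ n           ∎)

  ∣⇒·≈0 : ∀ {p m} → p · 1# ≈ 0# → p ℕD.∣ m → ∀ z → m · z ≈ 0#
  ∣⇒·≈0 {p} p·1≈0 (ℕD.divides q ≡.refl) z = begin
    (q ℕ.* p) · z  ≈⟨ ×-assocˡ z q p ⟨
    q · (p · z)    ≈⟨ ×-congʳ q p·z≈0 ⟩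
    q · 0#         ≈⟨ ·-zero q ⟩
    0#             ∎
    where
    p·z≈0 : p · z ≈ 0#
    p·z≈0 = begin
      p · z         ≈⟨ ×-congʳ p (*-identityˡ z) ⟨
      p · (1# * z)  ≈⟨ ×-assoc-* p 1# z ⟨
      (p · 1#) * z  ≈⟨ *-congʳ p·1≈0 ⟩
      0# * z        ≈⟨ zeroˡ z ⟩
      0#            ∎
    ·-zero : ∀ q → q · 0# ≈ 0#
    ·-zero zero    = refl
    ·-zero (suc q) = trans (+-identityˡ _) (·-zero q)

  freshman's-dream : ∀ {p} → Prime p → p · 1# ≈ 0# → ∀ x y → (x + y) ^ p ≈ x ^ p + y ^ p
  freshman's-dream {suc n} pr p·1≈0 x y = begin
    (x + y) ^ suc n                         ≈⟨ binomial-theorem (suc n) x y ⟩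
    term 0 + Σ (suc n) (λ k → term (suc k)) ≈⟨ +-congˡ (Σ-last n (λ k → term (suc k))) ⟩
    term 0 + (Σ n (λ k → term (suc k)) + term (suc n))
      ≈⟨ +-congˡ (+-congʳ (Σ-≈0 n (λ k k<n → ∣⇒·≈0 p·1≈0 (prime⇒p∣pCk pr (s≤s z≤n) (s≤s k<n)) _))) ⟩
    term 0 + (0# + term (suc n))            ≈⟨ +-congˡ (+-identityˡ _) ⟩
    term 0 + term (suc n)                   ≈⟨ +-comm _ _ ⟩
    term (suc n) + term 0                   ≈⟨ +-cong last-term first-term ⟩
    x ^ suc n + y ^ suc n                   ∎
    where
    term : ℕ → Carrier
    term k = (suc n C k) · (x ^ k * y ^ (suc n ∸ k))
    last-term : term (suc n) ≈ x ^ suc n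
    last-term = begin
      (suc n C suc n) · (x ^ suc n * y ^ (n ∸ n)) ≡⟨ ≡.cong (_· (x ^ suc n * y ^ (n ∸ n))) (nCn≡1 (suc n)) ⟩
      1 · (x ^ suc n * y ^ (n ∸ n))             ≈⟨ +-identityʳ _ ⟩
      x ^ suc n * y ^ (n ∸ n)                   ≡⟨ ≡.cong (λ e → x ^ suc n * y ^ e) (ℕP.n∸n≡0 n) ⟩
      x ^ suc n * 1#                            ≈⟨ *-identityʳ _ ⟩
      x ^ suc n                                 ∎
    first-term : term 0 ≈ y ^ suc n
    first-term = trans (+-identityʳ _) (*-identityˡ _)

open import Data.Integer as ℤ using (ℤ; +_; -_; _+_; _-_; _*_; 0ℤ; 1ℤ; -1ℤ; -[1+_]; ∣_∣)
import Data.Integer.Properties as ℤP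
import Data.Integer.Divisibility.Signed as Signed
open import Data.Integer.Tactic.RingSolver using (solve-∀)
open ≡ using (refl; sym; cong; cong₂; subst)

+[1+2k]≡1+2k : ∀ k → + suc (2 ℕ.* k) ≡ 1ℤ + + 2 * + k
+[1+2k]≡1+2k k = ≡.trans (ℤP.pos-+ 1 (2 ℕ.* k)) (≡.cong (λ z → 1ℤ + z) (ℤP.pos-* 2 k))

central-binomial-step : ∀ k → + suc k * + ((2 ℕ.* suc k) C suc k) ≡ + 2 * (1ℤ + + 2 * + k) * + ((2 ℕ.* k) C k)
central-binomial-step k = begin
  + suc k * + ((2 ℕ.* suc k) C suc k)        ≡⟨ ℤP.pos-* (suc k) ((2 ℕ.* suc k) C suc k) ⟨
  + (suc k ℕ.* ((2 ℕ.* suc k) C suc k))      ≡⟨ ≡.cong +_ ([k+1]*[2k+2]C[k+1]≡2*[2k+1]*[2k]Ck k) ⟩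
  + (2 ℕ.* suc (2 ℕ.* k) ℕ.* ((2 ℕ.* k) C k)) ≡⟨ ℤP.pos-* (2 ℕ.* suc (2 ℕ.* k)) ((2 ℕ.* k) C k) ⟩
  + (2 ℕ.* suc (2 ℕ.* k)) * + ((2 ℕ.* k) C k) ≡⟨ ≡.cong (_* + ((2 ℕ.* k) C k)) (ℤP.pos-* 2 (suc (2 ℕ.* k))) ⟩
  + 2 * + suc (2 ℕ.* k) * + ((2 ℕ.* k) C k)  ≡⟨ ≡.cong (λ z → + 2 * z * + ((2 ℕ.* k) C k)) (+[1+2k]≡1+2k k) ⟩
  + 2 * (1ℤ + + 2 * + k) * + ((2 ℕ.* k) C k) ∎
  where open ≡.≡-Reasoning

binomial-step : ∀ n k → + suc k * + (n C suc k) ≡ (+ n - + k) * + (n C k)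
binomial-step n k = begin
  + suc k * + (n C suc k)            ≡⟨ ℤP.pos-* (suc k) (n C suc k) ⟨
  + (suc k ℕ.* (n C suc k))          ≡⟨ cancel-+ (+ (suc k ℕ.* (n C suc k))) (+ (k ℕ.* (n C k))) ⟩
  + (suc k ℕ.* (n C suc k)) + + (k ℕ.* (n C k)) - + (k ℕ.* (n C k))
    ≡⟨ ≡.cong (_- + (k ℕ.* (n C k))) (ℤP.pos-+ (suc k ℕ.* (n C suc k)) (k ℕ.* (n C k))) ⟨
  + (suc k ℕ.* (n C suc k) ℕ.+ k ℕ.* (n C k)) - + (k ℕ.* (n C k))
    ≡⟨ ≡.cong (λ z → + z - + (k ℕ.* (n C k))) ([k+1]*nC[k+1]+k*nCk≡n*nCk n k) ⟩
  + (n ℕ.* (n C k)) - + (k ℕ.* (n C k)) ≡⟨ ≡.cong₂ _-_ (ℤP.pos-* n (n C k)) (ℤP.pos-* k (n C k)) ⟩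
  + n * + (n C k) - + k * + (n C k)  ≡⟨ factor (+ n) (+ k) (+ (n C k)) ⟩
  (+ n - + k) * + (n C k)            ∎
  where
  open ≡.≡-Reasoning
  cancel-+ : ∀ x y → x ≡ x + y - y
  cancel-+ = solve-∀
  factor : ∀ x y z → x * z - y * z ≡ (x - y) * z
  factor = solve-∀

module IntegersModulo (p : ℕ) where
  open Signed public using (_∣_)

  ∣-by : ∀ {x y} → x ≡ y → + p ∣ x → + p ∣ y
  ∣-by = subst (+ p ∣_)

  infix 4 _≈_
  -- A record rather than a synonym, so that Agda can infer a and b from a proof.
  record _≈_ (a b : ℤ) : Set where
    constructor mk
    field get : + p ∣ a - b
  open _≈_ public

  private
    a-a≡0 : ∀ a → 0ℤ ≡ a - a
    a-a≡0 = solve-∀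
    -[a-b]≡b-a : ∀ a b → - (a - b) ≡ b - a
    -[a-b]≡b-a = solve-∀
    telescope : ∀ a b c → (a - b) + (b - c) ≡ a - c
    telescope = solve-∀
    sum-of-diffs : ∀ a b c d → (a - b) + (c - d) ≡ (a + c) - (b + d)
    sum-of-diffs = solve-∀
    product-diff : ∀ a b c d → (a - b) * c + b * (c - d) ≡ a * c - b * d
    product-diff = solve-∀
    neg-diff : ∀ a b → - (a - b) ≡ - a - - b
    neg-diff = solve-∀

  ≈-refl : ∀ {a} → a ≈ a
  ≈-refl {a} = mk (∣-by (a-a≡0 a) (Signed.divides 0ℤ refl))

  ≈-reflexive : ∀ {a b} → a ≡ b → a ≈ b
  ≈-reflexive refl = ≈-refl

  ≈-sym : ∀ {a b} → a ≈ b → b ≈ a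
  ≈-sym {a} {b} (mk e) = mk (∣-by (-[a-b]≡b-a a b) (Signed.∣m⇒∣-m e))

  ≈-trans : ∀ {a b c} → a ≈ b → b ≈ c → a ≈ c
  ≈-trans {a} {b} {c} (mk e) (mk f) = mk (∣-by (telescope a b c) (Signed.∣m∣n⇒∣m+n e f))

  +-cong : ∀ {a b c d} → a ≈ b → c ≈ d → a + c ≈ b + d
  +-cong {a} {b} {c} {d} (mk e) (mk f) = mk (∣-by (sum-of-diffs a b c d) (Signed.∣m∣n⇒∣m+n e f))

  *-cong : ∀ {a b c d} → a ≈ b → c ≈ d → a * c ≈ b * d
  *-cong {a} {b} {c} {d} (mk e) (mk f) =
    mk (∣-by (product-diff a b c d) (Signed.∣m∣n⇒∣m+n (Signed.∣m⇒∣m*n c e) (Signed.∣n⇒∣m*n b f)))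

  -‿cong : ∀ {a b} → a ≈ b → - a ≈ - b
  -‿cong {a} {b} (mk e) = mk (∣-by (neg-diff a b) (Signed.∣m⇒∣-m e))

  ≈-isEquivalence : IsEquivalence _≈_
  ≈-isEquivalence = record { refl = ≈-refl ; sym = ≈-sym ; trans = ≈-trans }

  ℤₚ : CommutativeRing 0ℓ 0ℓ
  ℤₚ = coarsenRing ℤP.+-*-commutativeRing _≈_ ≈-isEquivalence ≈-reflexive +-cong *-cong -‿cong

  ≈0⇒∣ : ∀ {a} → a ≈ 0ℤ → + p ∣ a
  ≈0⇒∣ {a} (mk e) = ∣-by (ℤP.+-identityʳ a) e

  ∣⇒≈0 : ∀ {a} → + p ∣ a → a ≈ 0ℤ
  ∣⇒≈0 {a} e = mk (∣-by (sym (ℤP.+-identityʳ a)) e)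

  p≈0 : + p ≈ 0ℤ
  p≈0 = ∣⇒≈0 Signed.∣-refl

  euclid : Prime p → ∀ a b → + p ∣ a * b → (+ p ∣ a) ⊎ (+ p ∣ b)
  euclid pr a b p∣ab with euclidsLemma ∣ a ∣ ∣ b ∣ pr (subst (p ℕD.∣_) (ℤP.abs-* a b) (Signed.∣⇒∣ᵤ p∣ab))
  ... | inj₁ p∣a = inj₁ (Signed.∣ᵤ⇒∣ p∣a)
  ... | inj₂ p∣b = inj₂ (Signed.∣ᵤ⇒∣ p∣b)

module FractionSums (p : ℕ) where
  open IntegersModulo p
  open RingSums ℤₚ using (Σ; Σ-last)
  open import Relation.Binary.Reasoning.Setoid (CommutativeRing.setoid ℤₚ)

  numerator≈ : ∀ n (a b β : ℕ → ℤ) → (∀ k → b k * β k ≈ 1ℤ) →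
    proj₁ (sumFrac n (λ k → (a k , b k))) ≈ proj₂ (sumFrac n (λ k → (a k , b k))) * Σ n (λ k → a k * β k)
  numerator≈ zero    a b β bβ≈1 = ≈-refl
  numerator≈ (suc n) a b β bβ≈1 = ≈-sym (begin
    (D * b n) * Σ (suc n) aβ               ≈⟨ *-cong (≈-refl {D * b n}) (Σ-last n aβ) ⟩
    (D * b n) * (Σ n aβ + a n * β n)       ≡⟨ expand D (b n) (Σ n aβ) (a n) (β n) ⟩
    (D * Σ n aβ) * b n + (D * a n) * (b n * β n)
      ≈⟨ +-cong (*-cong (≈-sym (numerator≈ n a b β bβ≈1)) (≈-refl {b n})) (*-cong (≈-refl {D * a n}) (bβ≈1 n)) ⟩
    N * b n + (D * a n) * 1ℤ               ≡⟨ collect N (b n) D (a n) ⟩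
    N * b n + a n * D                      ∎)
    where
    aβ = λ k → a k * β k
    N = proj₁ (sumFrac n (λ k → (a k , b k)))
    D = proj₂ (sumFrac n (λ k → (a k , b k)))
    expand : ∀ D b S a β → (D * b) * (S + a * β) ≡ (D * S) * b + (D * a) * (b * β)
    expand = solve-∀
    collect : ∀ N b D a → N * b + (D * a) * 1ℤ ≡ N * b + a * D
    collect = solve-∀

  ≡[modQ]-intro : ∀ (x : Frac) {S c e} → proj₁ x ≈ proj₂ x * S → S * e ≈ c → x ≡ (c , e) [modQ p ]
  ≡[modQ]-intro (N , D) {S} {c} {e} N≈DS Se≈c = Signed.∣⇒∣ᵤ (≈0⇒∣ (begin
    N * e - c * D        ≈⟨ +-cong (*-cong N≈DS (≈-refl {e})) (≈-refl { - (c * D)}) ⟩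
    (D * S) * e - c * D  ≡⟨ reassoc D S e c ⟩
    D * (S * e) - c * D  ≈⟨ +-cong (*-cong (≈-refl {D}) Se≈c) (≈-refl { - (c * D)}) ⟩
    D * c - c * D        ≡⟨ vanish D c ⟩
    0ℤ                   ∎))
    where
    reassoc : ∀ D S e c → (D * S) * e - c * D ≡ D * (S * e) - c * D
    reassoc = solve-∀
    vanish : ∀ D c → D * c - c * D ≡ 0ℤ
    vanish = solve-∀

module PrimeModulus (p : ℕ) (pr : Prime p) where
  open IntegersModulo p public
  open RingSums ℤₚ public
  open import Relation.Binary.Reasoning.Setoid (CommutativeRing.setoid ℤₚ)

  instance
    p≢0 : ℕ.NonZero p
    p≢0 = prime⇒nonZero pr

  1<p : 1 < p
  1<p = ℕ.nonTrivial⇒n>1 p {{prime⇒nonTrivial pr}}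

  ¬∣-between-0-and-p : ∀ {x} → 0 < x → x < p → ¬ (+ p ∣ + x)
  ¬∣-between-0-and-p {suc x} _ x<p p∣x = ℕP.<⇒≱ x<p (ℕD.∣⇒≤ (Signed.∣⇒∣ᵤ p∣x))

  1≉0 : ¬ (1ℤ ≈ 0ℤ)
  1≉0 1≈0 = ¬∣-between-0-and-p (s≤s z≤n) 1<p (≈0⇒∣ 1≈0)

  cancel : ∀ {c x y} → ¬ (+ p ∣ c) → c * x ≈ c * y → x ≈ y
  cancel {c} {x} {y} p∤c (mk p∣cx-cy) with euclid pr c (x - y) (∣-by (≡.sym (factor c x y)) p∣cx-cy)
    where
    factor : ∀ c x y → c * (x - y) ≡ c * x - c * y
    factor = solve-∀
  ... | inj₁ p∣c   = ⊥-elim (p∤c p∣c)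
  ... | inj₂ p∣x-y = mk p∣x-y

  ∤-* : ∀ {a b} → ¬ (+ p ∣ a) → ¬ (+ p ∣ b) → ¬ (+ p ∣ a * b)
  ∤-* {a} {b} p∤a p∤b p∣ab = [ p∤a , p∤b ]′ (euclid pr a b p∣ab)

  freshman's-dreamₚ : ∀ x y → (x + y) ^ p ≈ x ^ p + y ^ p
  freshman's-dreamₚ = freshman's-dream pr p·1≈0
    where
    n·1≡n : ∀ n → n · 1ℤ ≡ + n
    n·1≡n zero    = ≡.refl
    n·1≡n (suc n) = ≡.trans (≡.cong (λ z → 1ℤ + z) (n·1≡n n)) (≡.sym (ℤP.pos-+ 1 n))
    p·1≈0 : p · 1ℤ ≈ 0ℤ
    p·1≈0 = ≈-trans (≈-reflexive (n·1≡n p)) p≈0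

  p≡1+[p-1] : p ≡ suc (ℕ.pred p)
  p≡1+[p-1] = ≡.sym (ℕP.suc-pred p)

  0^p≈0 : 0ℤ ^ p ≈ 0ℤ
  0^p≈0 = ≈-reflexive (≡.cong (0ℤ ^_) p≡1+[p-1])

  ℤ^≡^ : ∀ a k → a ℤ.^ k ≡ a ^ k
  ℤ^≡^ a zero    = ≡.refl
  ℤ^≡^ a (suc k) = ≡.cong (a *_) (ℤ^≡^ a k)

  1^n≈1 : ∀ n → 1ℤ ^ n ≈ 1ℤ
  1^n≈1 zero    = ≈-refl
  1^n≈1 (suc n) = ≈-trans (≈-reflexive (ℤP.*-identityˡ _)) (1^n≈1 n)

  fermat : ∀ a → a ^ p ≈ a
  fermat (+ n)    = fermat-ℕ n
    where
    fermat-ℕ : ∀ n → (+ n) ^ p ≈ + n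
    fermat-ℕ zero    = 0^p≈0
    fermat-ℕ (suc n) = begin
      (1ℤ + + n) ^ p      ≈⟨ freshman's-dreamₚ 1ℤ (+ n) ⟩
      1ℤ ^ p + (+ n) ^ p  ≈⟨ +-cong (1^n≈1 p) (fermat-ℕ n) ⟩
      1ℤ + + n            ∎
  fermat -[1+ n ] = ≈-trans (inverseʳ-unique x^p (-[1+ n ] ^ p) sum≈0) (-‿cong (fermat x))
    where
    open import Algebra.Properties.Group (CommutativeRing.+-group ℤₚ) using (inverseʳ-unique)
    x = + suc n
    x^p = x ^ p
    sum≈0 : x ^ p + -[1+ n ] ^ p ≈ 0ℤ
    sum≈0 = begin
      x ^ p + -[1+ n ] ^ p  ≈⟨ freshman's-dreamₚ x -[1+ n ] ⟨
      (x - x) ^ p           ≡⟨ ≡.cong (_^ p) (ℤP.+-inverseʳ x) ⟩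
      0ℤ ^ p                ≈⟨ 0^p≈0 ⟩
      0ℤ                    ∎

  fermat-1 : ∀ {a} → ¬ (+ p ∣ a) → a ^ ℕ.pred p ≈ 1ℤ
  fermat-1 {a} p∤a = cancel p∤a (begin
    a * a ^ ℕ.pred p  ≡⟨ ≡.cong (a ^_) p≡1+[p-1] ⟨
    a ^ p             ≈⟨ fermat a ⟩
    a                 ≡⟨ ℤP.*-identityʳ a ⟨
    a * 1ℤ            ∎)

  _⁻¹ : ℤ → ℤ
  a ⁻¹ = a ^ ℕ.pred (ℕ.pred p)

  *-inverseʳ : ∀ {a} → ¬ (+ p ∣ a) → a * a ⁻¹ ≈ 1ℤ
  *-inverseʳ {a} p∤a = ≈-trans (≈-reflexive (≡.cong (a ^_) (ℕP.suc-pred (ℕ.pred p) {{p-1≢0}}))) (fermat-1 p∤a)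
    where
    p-1≢0 : ℕ.NonZero (ℕ.pred p)
    p-1≢0 = ℕ.>-nonZero (ℕP.pred-mono-≤ 1<p)


  square≈1 : ∀ {y} → y * y ≈ 1ℤ → y ≈ 1ℤ ⊎ y ≈ -1ℤ
  square≈1 {y} (mk p∣y²-1) = Sum.map mk (λ p∣y+1 → mk (∣-by (plus y) p∣y+1))
    (euclid pr (y - 1ℤ) (y + 1ℤ) (∣-by (difference-of-squares y) p∣y²-1))
    where
    difference-of-squares : ∀ y → y * y - 1ℤ ≡ (y - 1ℤ) * (y + 1ℤ)
    difference-of-squares = solve-∀
    plus : ∀ y → y + 1ℤ ≡ y - -1ℤ
    plus = solve-∀

module RootCounting (p : ℕ) (pr : Prime p) where
  open PrimeModulus p pr
  open import Relation.Binary.Reasoning.Setoid (CommutativeRing.setoid ℤₚ)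

  -- Modulo p, f is a monic polynomial function of degree d, presented by Horner's scheme.
  data Monic : ℕ → (ℤ → ℤ) → Set where
    one    : ∀ {f} → (∀ x → f x ≈ 1ℤ) → Monic 0 f
    horner : ∀ {d f} g c → Monic d g → (∀ x → f x ≈ x * g x + c) → Monic (suc d) f

  ^-monic : ∀ d → Monic d (_^ d)
  ^-monic zero    = one (λ _ → ≈-refl)
  ^-monic (suc d) = horner (_^ d) 0ℤ (^-monic d) (λ x → ≈-reflexive (≡.sym (ℤP.+-identityʳ _)))

  factor-theorem : ∀ {d f} → Monic (suc d) f → ∀ r →
    Σ[ h ∈ (ℤ → ℤ) ] Monic d h × (∀ x → f x ≈ (x - r) * h x + f r)
  factor-theorem {zero} {f} (horner g c (one g≈1) f≈) r = (λ _ → 1ℤ) , one (λ _ → ≈-refl) , λ x → begin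
    f x                          ≈⟨ f≈ x ⟩
    x * g x + c                  ≈⟨ +-cong (*-cong (≈-refl {x}) (g≈1 x)) (≈-refl {c}) ⟩
    x * 1ℤ + c                   ≡⟨ linear x r c ⟩
    (x - r) * 1ℤ + (r * 1ℤ + c)  ≈⟨ +-cong (≈-refl {(x - r) * 1ℤ}) (+-cong (*-cong (≈-refl {r}) (≈-sym (g≈1 r))) (≈-refl {c})) ⟩
    (x - r) * 1ℤ + (r * g r + c) ≈⟨ +-cong (≈-refl {(x - r) * 1ℤ}) (≈-sym (f≈ r)) ⟩
    (x - r) * 1ℤ + f r           ∎
    where
    linear : ∀ x r c → x * 1ℤ + c ≡ (x - r) * 1ℤ + (r * 1ℤ + c)
    linear = solve-∀
  factor-theorem {suc d} {f} (horner g c mg f≈) r with factor-theorem mg r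
  ... | h , mh , g≈ = (λ x → x * h x + g r) , horner h (g r) mh (λ _ → ≈-refl) , λ x → begin
    f x                                   ≈⟨ f≈ x ⟩
    x * g x + c                           ≈⟨ +-cong (*-cong (≈-refl {x}) (g≈ x)) (≈-refl {c}) ⟩
    x * ((x - r) * h x + g r) + c         ≡⟨ shift x r (h x) (g r) c ⟩
    (x - r) * (x * h x + g r) + (r * g r + c) ≈⟨ +-cong (≈-refl {(x - r) * (x * h x + g r)}) (≈-sym (f≈ r)) ⟩
    (x - r) * (x * h x + g r) + f r       ∎
    where
    shift : ∀ x r h gr c → x * ((x - r) * h + gr) + c ≡ (x - r) * (x * h + gr) + (r * gr + c)
    shift = solve-∀

  roots≤degree : ∀ {d f} → Monic d f → ∀ m (r : ℕ → ℤ) →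
    (∀ {i j} → i < j → j < m → ¬ (r i ≈ r j)) → (∀ {k} → k < m → f (r k) ≈ 0ℤ) → m ≤ d
  roots≤degree _        zero    r distinct roots = z≤n
  roots≤degree (one f≈1) (suc m) r distinct roots = ⊥-elim (1≉0 (≈-trans (≈-sym (f≈1 (r 0))) (roots (s≤s z≤n))))
  roots≤degree {suc d} {f} mf (suc m) r distinct roots with factor-theorem mf (r m)
  ... | h , mh , f≈ = s≤s (roots≤degree mh m r (λ i<j j<m → distinct i<j (ℕP.m<n⇒m<1+n j<m)) h-roots)
    where
    h-roots : ∀ {k} → k < m → h (r k) ≈ 0ℤ
    h-roots {k} k<m = [ (λ p∣diff → ⊥-elim (distinct k<m ℕP.≤-refl (mk p∣diff))) , ∣⇒≈0 ]′
      (euclid pr (r k - r m) (h (r k)) (≈0⇒∣ (begin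
        (r k - r m) * h (r k)         ≡⟨ ℤP.+-identityʳ _ ⟨
        (r k - r m) * h (r k) + 0ℤ    ≈⟨ +-cong (≈-refl {(r k - r m) * h (r k)}) (≈-sym (roots ℕP.≤-refl)) ⟩
        (r k - r m) * h (r k) + f (r m) ≈⟨ f≈ (r k) ⟨
        f (r k)                       ≈⟨ roots (ℕP.m<n⇒m<1+n k<m) ⟩
        0ℤ                            ∎)))

module OddPrimeModulus (p n : ℕ) (pr : Prime p) (p≡2n+1 : p ≡ suc (2 ℕ.* n)) where
  open PrimeModulus p pr public
  open RootCounting p pr
  open import Relation.Binary.Reasoning.Setoid (CommutativeRing.setoid ℤₚ)

  n<p : n < p
  n<p = ≡.subst (n <_) (≡.sym p≡2n+1) (s≤s (ℕP.m≤m+n n (n ℕ.+ 0)))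

  instance
    n≢0 : ℕ.NonZero n
    n≢0 = ℕ.>-nonZero (ℕP.n≢0⇒n>0 λ n≡0 → ℕP.<-irrefl (≡.sym (≡.trans p≡2n+1 (≡.cong (λ k → suc (2 ℕ.* k)) n≡0))) 1<p)

  p∤2 : ¬ (+ p ∣ + 2)
  p∤2 = ¬∣-between-0-and-p (s≤s z≤n) (≡.subst (2 <_) (≡.sym p≡2n+1) (s≤s (ℕP.*-monoʳ-≤ 2 (ℕP.n≢0⇒n>0 (ℕ.≢-nonZero⁻¹ n)))))

  p∤-2 : ¬ (+ p ∣ - + 2)
  p∤-2 p∣-2 = p∤2 (∣-by (ℤP.neg-involutive (+ 2)) (Signed.∣m⇒∣-m p∣-2))

  p-1≡n+n : ℕ.pred p ≡ n ℕ.+ n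
  p-1≡n+n = ≡.trans (≡.cong ℕ.pred p≡2n+1) (≡.cong (n ℕ.+_) (ℕP.+-identityʳ n))

  square^n≈1 : ∀ {x} → ¬ (+ p ∣ x) → (x * x) ^ n ≈ 1ℤ
  square^n≈1 {x} p∤x = begin
    (x * x) ^ n    ≈⟨ ^-distrib-* x x n ⟩
    x ^ n * x ^ n  ≈⟨ ^-homo-* x n n ⟨
    x ^ (n ℕ.+ n)  ≡⟨ ≡.cong (x ^_) p-1≡n+n ⟨
    x ^ ℕ.pred p   ≈⟨ fermat-1 p∤x ⟩
    1ℤ             ∎

  squares-distinct : ∀ {i j} → 0 < i → i < j → j ≤ n → ¬ (+ i * + i ≈ + j * + j)
  squares-distinct {i} {j} 0<i i<j j≤n (mk p∣i²-j²) =
    [ ¬∣-between-0-and-p (ℕP.m<n⇒0<n∸m i<j) j-i<p ∘ p∣j-i , ¬∣-between-0-and-p (ℕP.<-≤-trans 0<i (ℕP.m≤m+n i j)) i+j<p ]′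
      (euclid pr (+ i - + j) (+ i + + j) (∣-by (difference-of-squares (+ i) (+ j)) p∣i²-j²))
    where
    difference-of-squares : ∀ x y → x * x - y * y ≡ (x - y) * (x + y)
    difference-of-squares = solve-∀
    p∣j-i : + p ∣ + i - + j → + p ∣ + (j ℕ.∸ i)
    p∣j-i p∣i-j = ∣-by (≡.trans (negate (+ i) (+ j)) (≡.trans (ℤP.m-n≡m⊖n j i) (ℤP.⊖-≥ (ℕP.<⇒≤ i<j)))) (Signed.∣m⇒∣-m p∣i-j)
      where
      negate : ∀ x y → - (x - y) ≡ y - x
      negate = solve-∀
    j-i<p : j ℕ.∸ i < p
    j-i<p = ℕP.≤-<-trans (ℕP.m∸n≤m j i) (ℕP.≤-<-trans j≤n n<p)
    i+j<p : i ℕ.+ j < p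
    i+j<p = ≡.subst (i ℕ.+ j <_) (≡.sym p≡2n+1)
      (s≤s (ℕP.+-mono-≤ (ℕP.≤-trans (ℕP.<⇒≤ i<j) j≤n) (ℕP.≤-trans j≤n (ℕP.m≤m+n n 0))))

  -- a and the squares 1², …, n² would be n + 1 distinct roots of xⁿ - 1.
  nonresidue^n≉1 : ∀ {a} → (∀ {x} → 0 < x → x ≤ n → ¬ (a ≈ + x * + x)) → ¬ (a ^ n ≈ 1ℤ)
  nonresidue^n≉1 {a} nonresidue a^n≈1 =
    ℕP.<-irrefl ≡.refl (roots≤degree xⁿ-1-monic (suc n) root distinct is-root)
    where
    xⁿ-1-monic : Monic n (λ x → x ^ n - 1ℤ)
    xⁿ-1-monic = ≡.subst (λ d → Monic d (λ x → x ^ d - 1ℤ)) (ℕP.suc-pred n)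
      (horner _ -1ℤ (^-monic (ℕ.pred n)) (λ _ → ≈-refl))
    root : ℕ → ℤ
    root zero    = a
    root (suc k) = + suc k * + suc k
    distinct : ∀ {i j} → i < j → j < suc n → ¬ (root i ≈ root j)
    distinct {zero}  {suc j} _         (s≤s j<n) = nonresidue (s≤s z≤n) j<n
    distinct {suc i} {suc j} (s≤s i<j) (s≤s j<n) = squares-distinct (s≤s z≤n) (s≤s i<j) j<n
    ≈1⇒root : ∀ {y} → y ≈ 1ℤ → y - 1ℤ ≈ 0ℤ
    ≈1⇒root y≈1 = +-cong y≈1 (≈-refl { -1ℤ})
    is-root : ∀ {k} → k < suc n → root k ^ n - 1ℤ ≈ 0ℤ
    is-root {zero}  _         = ≈1⇒root a^n≈1
    is-root {suc k} (s≤s k<n) =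
      ≈1⇒root (square^n≈1 (¬∣-between-0-and-p (s≤s z≤n) (ℕP.≤-<-trans k<n n<p)))

  euler-criterion : ∀ a → legendre a p ≈ a ^ n
  euler-criterion a = by-cases (p ℕD.∣? ∣ a ∣) (any? (λ x → p ℕD.∣? ∣ + x * + x - a ∣) (upTo p))
    where
    by-cases : (p∣a? : Dec (p ℕD.∣ ∣ a ∣)) (square? : Dec (Any (λ x → p ℕD.∣ ∣ + x * + x - a ∣) (upTo p))) →
               (if does p∣a? then 0ℤ else if does square? then 1ℤ else - 1ℤ) ≈ a ^ n
    by-cases (yes p∣a) _ = ≈-sym (begin
      a ^ n                      ≡⟨ ≡.cong (a ^_) (ℕP.suc-pred n) ⟨
      a * a ^ ℕ.pred n           ≈⟨ *-cong (∣⇒≈0 (Signed.∣ᵤ⇒∣ {i = a} p∣a)) (≈-refl {a ^ ℕ.pred n}) ⟩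
      0ℤ * a ^ ℕ.pred n          ≡⟨ ℤP.*-zeroˡ (a ^ ℕ.pred n) ⟩
      0ℤ                         ∎)
    by-cases (no p∤a) (yes square) with satisfied square
    ... | x , p∣x²-a = ≈-sym (begin
      a ^ n          ≈⟨ ^-congˡ n (≈-sym x²≈a) ⟩
      (+ x * + x) ^ n ≈⟨ square^n≈1 p∤x ⟩
      1ℤ             ∎)
      where
      x²≈a : + x * + x ≈ a
      x²≈a = mk (Signed.∣ᵤ⇒∣ p∣x²-a)
      p∤x : ¬ (+ p ∣ + x)
      p∤x p∣x = p∤a (Signed.∣⇒∣ᵤ (≈0⇒∣ (≈-trans (≈-sym x²≈a) (∣⇒≈0 (Signed.∣m⇒∣m*n (+ x) p∣x)))))
    by-cases (no p∤a) (no nonsquare) =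
      ≈-sym ([ ⊥-elim ∘ nonresidue^n≉1 nonresidue , (λ a^n≈-1 → a^n≈-1) ]′ (square≈1 (begin
        a ^ n * a ^ n  ≈⟨ ^-homo-* a n n ⟨
        a ^ (n ℕ.+ n)  ≡⟨ ≡.cong (a ^_) p-1≡n+n ⟨
        a ^ ℕ.pred p   ≈⟨ fermat-1 (p∤a ∘ Signed.∣⇒∣ᵤ) ⟩
        1ℤ             ∎)))
      where
      nonresidue : ∀ {x} → 0 < x → x ≤ n → ¬ (a ≈ + x * + x)
      nonresidue {x} _ x≤n a≈x² =
        nonsquare (applyUpTo⁺ (λ y → y) (Signed.∣⇒∣ᵤ (get (≈-sym a≈x²))) (ℕP.≤-<-trans x≤n n<p))

  -- 2(2k + 1) + 4(n - k) = 2p, so the two recursions agree modulo p.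
  central-binomial≈ : ∀ {k} → k < p → + ((2 ℕ.* k) C k) ≈ (- + 4) ^ k * + (n C k)
  central-binomial≈ {zero}  _     = ≈-refl
  central-binomial≈ {suc k} 1+k<p = cancel (¬∣-between-0-and-p (s≤s z≤n) 1+k<p) (begin
    + suc k * + ((2 ℕ.* suc k) C suc k)            ≡⟨ central-binomial-step k ⟩
    + 2 * (1ℤ + + 2 * + k) * c₂ₖ                   ≈⟨ *-cong (≈-refl {+ 2 * (1ℤ + + 2 * + k)})
                                                        (central-binomial≈ (ℕP.<-trans (ℕP.n<1+n k) 1+k<p)) ⟩
    + 2 * (1ℤ + + 2 * + k) * ((- + 4) ^ k * cₙ)   ≈⟨ mk (Signed.divides (+ 2 * (- + 4) ^ k * cₙ) twice-p) ⟩
    (- + 4) ^ suc k * ((+ n - + k) * cₙ)          ≡⟨ ≡.cong ((- + 4) ^ suc k *_) (binomial-step n k) ⟨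
    (- + 4) ^ suc k * (+ suc k * + (n C suc k))   ≡⟨ swap ((- + 4) ^ suc k) (+ suc k) (+ (n C suc k)) ⟩
    + suc k * ((- + 4) ^ suc k * + (n C suc k))   ∎)
    where
    c₂ₖ = + ((2 ℕ.* k) C k)
    cₙ = + (n C k)
    swap : ∀ a b c → a * (b * c) ≡ b * (a * c)
    swap = solve-∀
    identity : ∀ k n y c → + 2 * (1ℤ + + 2 * k) * (y * c) - - + 4 * y * ((n - k) * c) ≡ (+ 2 * y * c) * (1ℤ + + 2 * n)
    identity = solve-∀
    twice-p : + 2 * (1ℤ + + 2 * + k) * ((- + 4) ^ k * cₙ) - (- + 4) ^ suc k * ((+ n - + k) * cₙ)
              ≡ (+ 2 * (- + 4) ^ k * cₙ) * + p
    twice-p = ≡.trans (identity (+ k) (+ n) ((- + 4) ^ k) cₙ)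
                (≡.cong ((+ 2 * (- + 4) ^ k * cₙ) *_) (≡.sym (≡.trans (≡.cong +_ p≡2n+1) (+[1+2k]≡1+2k n))))

private
  orbit-induction : {S : Set} {P : ℕ → S → Set} (f : S → S) →
    (∀ s → P 0 s) → (∀ k s → P k (f s) → P (suc k) s) → ∀ n s → P n s
  orbit-induction f base step zero    s = base s
  orbit-induction {P = P} f base step (suc n) s = step n s (orbit-induction {P = P} f base step n (f s))

  seed : ℤ → ℤ → ℤ × ℤ
  seed x y = (x , y)

  shift-by-2 : ∀ (w : ℕ → ℤ) A B → (∀ m → w (m ℕ.+ 2) ≡ A * w (m ℕ.+ 1) - B * w m) →
               ∀ m → w (suc (suc m)) ≡ A * w (suc m) - B * w m
  shift-by-2 w A B rec m = ≡.trans (cong w (ℕP.+-comm 2 m))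
    (≡.trans (rec m) (cong (λ k → A * w k - B * w m) (ℕP.+-comm m 1)))

-- Defs iterates a private step map from a fixed seed. Abstracting the seed with `with` turns the goal
-- into a statement about an arbitrary seed, which holds by induction along the orbit of the step map.
u-recurrence : ∀ A B m → u A B (suc (suc m)) ≡ A * u A B (suc m) - B * u A B m
u-recurrence A B = shift-by-2 (u A B) A B orbit
  where
  orbit : ∀ m → u A B (m ℕ.+ 2) ≡ A * u A B (m ℕ.+ 1) - B * u A B m
  orbit with seed 0ℤ 1ℤ | orbit-induction {P = _} (λ s → (proj₂ s , A * proj₂ s - B * proj₁ s)) (λ _ → refl) (λ _ _ ih → ih)
  ... | s | along = λ m → along m s

v-recurrence : ∀ A B m → v A B (suc (suc m)) ≡ A * v A B (suc m) - B * v A B m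
v-recurrence A B = shift-by-2 (v A B) A B orbit
  where
  orbit : ∀ m → v A B (m ℕ.+ 2) ≡ A * v A B (m ℕ.+ 1) - B * v A B m
  orbit with seed (+ 2) A | orbit-induction {P = _} (λ s → (proj₂ s , A * proj₂ s - B * proj₁ s)) (λ _ → refl) (λ _ _ ih → ih)
  ... | s | along = λ m → along m s

module LucasSequences (A B : ℤ) where

  -- α^k = κ k + u_k α in ℤ[α], with α² = A α - B.
  κ : ℕ → ℤ
  κ zero    = 1ℤ
  κ (suc k) = - B * u A B k

  u-suc : ∀ k → u A B (suc k) ≡ κ k + A * u A B k
  u-suc zero    = solve-0 A
    where
    solve-0 : ∀ A → 1ℤ ≡ 1ℤ + A * 0ℤ
    solve-0 = solve-∀
  u-suc (suc k) = ≡.trans (u-recurrence A B k) (reorder A B (u A B k) (u A B (suc k)))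
    where
    reorder : ∀ A B a b → A * b - B * a ≡ - B * a + A * b
    reorder = solve-∀

  v≡2κ+Au : ∀ k → v A B k ≡ + 2 * κ k + A * u A B k
  v≡2κ+Au zero          = v₀ A
    where
    v₀ : ∀ A → + 2 ≡ + 2 * 1ℤ + A * 0ℤ
    v₀ = solve-∀
  v≡2κ+Au (suc zero)    = v₁ A B
    where
    v₁ : ∀ A B → A ≡ + 2 * (- B * 0ℤ) + A * 1ℤ
    v₁ = solve-∀
  v≡2κ+Au (suc (suc k)) = begin
    v A B (suc (suc k))                                   ≡⟨ v-recurrence A B k ⟩
    A * v A B (suc k) - B * v A B k                       ≡⟨ cong₂ (λ a b → A * a - B * b) (v≡2κ+Au (suc k)) (v≡2κ+Au k) ⟩
    A * (+ 2 * κ (suc k) + A * u₁) - B * (+ 2 * κ k + A * u₀) ≡⟨ regroup A B u₀ u₁ (κ k) ⟩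
    + 2 * (- B * (κ k + A * u₀)) + A * (A * u₁ - B * u₀)  ≡⟨ cong₂ (λ a b → + 2 * (- B * a) + A * b) (u-suc k) (u-recurrence A B k) ⟨
    + 2 * κ (suc (suc k)) + A * u A B (suc (suc k))       ∎
    where
    open ≡.≡-Reasoning
    u₀ = u A B k
    u₁ = u A B (suc k)
    regroup : ∀ A B u₀ u₁ κ₀ → A * (+ 2 * (- B * u₀) + A * u₁) - B * (+ 2 * κ₀ + A * u₀)
                             ≡ + 2 * (- B * (κ₀ + A * u₀)) + A * (A * u₁ - B * u₀)
    regroup = solve-∀

module QuadraticExtension (A B : ℤ) where

  -- (a , b) stands for a + b α, where α² = A α - B.
  ℤ[α] : Set
  ℤ[α] = ℤ × ℤ

  infixl 6 _⊞_
  infixl 7 _⊠_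
  _⊞_ : ℤ[α] → ℤ[α] → ℤ[α]
  (a , b) ⊞ (c , d) = (a + c , b + d)

  _⊠_ : ℤ[α] → ℤ[α] → ℤ[α]
  (a , b) ⊠ (c , d) = (a * c - B * b * d , a * d + b * c + A * b * d)

  ⊟_ : ℤ[α] → ℤ[α]
  ⊟ (a , b) = (- a , - b)

  private
    pair : ∀ {a b c d : ℤ} → a ≡ c → b ≡ d → (a , b) ≡ (c , d)
    pair = cong₂ _,_
    +-assoc : ∀ a b c → a + b + c ≡ a + (b + c)
    +-assoc = solve-∀
    +-identity : ∀ a → 0ℤ + a ≡ a
    +-identity = solve-∀
    +-inverse : ∀ a → - a + a ≡ 0ℤ
    +-inverse = solve-∀
    +-comm : ∀ a b → a + b ≡ b + a
    +-comm = solve-∀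
    ⊠-assoc₁ : ∀ A B a b c d e f → (a * c - B * b * d) * e - B * (a * d + b * c + A * b * d) * f
                             ≡ a * (c * e - B * d * f) - B * b * (c * f + d * e + A * d * f)
    ⊠-assoc₁ = solve-∀
    ⊠-assoc₂ : ∀ A B a b c d e f → (a * c - B * b * d) * f + (a * d + b * c + A * b * d) * e + A * (a * d + b * c + A * b * d) * f
                             ≡ a * (c * f + d * e + A * d * f) + b * (c * e - B * d * f) + A * b * (c * f + d * e + A * d * f)
    ⊠-assoc₂ = solve-∀
    ⊠-comm₁ : ∀ A B a b c d → a * c - B * b * d ≡ c * a - B * d * b
    ⊠-comm₁ = solve-∀
    ⊠-comm₂ : ∀ A B a b c d → a * d + b * c + A * b * d ≡ c * b + d * a + A * d * b
    ⊠-comm₂ = solve-∀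
    ⊠-identity₁ : ∀ A B a b → 1ℤ * a - B * 0ℤ * b ≡ a
    ⊠-identity₁ = solve-∀
    ⊠-identity₂ : ∀ A B a b → 1ℤ * b + 0ℤ * a + A * 0ℤ * b ≡ b
    ⊠-identity₂ = solve-∀
    distrib₁ : ∀ A B a b c d e f → a * (c + e) - B * b * (d + f) ≡ (a * c - B * b * d) + (a * e - B * b * f)
    distrib₁ = solve-∀
    distrib₂ : ∀ A B a b c d e f → a * (d + f) + b * (c + e) + A * b * (d + f)
                             ≡ (a * d + b * c + A * b * d) + (a * f + b * e + A * b * f)
    distrib₂ = solve-∀

  ⊠-comm : ∀ x y → x ⊠ y ≡ y ⊠ x
  ⊠-comm (a , b) (c , d) = pair (⊠-comm₁ A B a b c d) (⊠-comm₂ A B a b c d)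

  ⊠-identityˡ : ∀ x → (1ℤ , 0ℤ) ⊠ x ≡ x
  ⊠-identityˡ (a , b) = pair (⊠-identity₁ A B a b) (⊠-identity₂ A B a b)

  ⊠-distribˡ : ∀ x y z → x ⊠ (y ⊞ z) ≡ x ⊠ y ⊞ x ⊠ z
  ⊠-distribˡ (a , b) (c , d) (e , f) = pair (distrib₁ A B a b c d e f) (distrib₂ A B a b c d e f)

  ring : CommutativeRing 0ℓ 0ℓ
  ring = record
    { Carrier = ℤ[α] ; _≈_ = _≡_ ; _+_ = _⊞_ ; _*_ = _⊠_ ; -_ = ⊟_ ; 0# = (0ℤ , 0ℤ) ; 1# = (1ℤ , 0ℤ)
    ; isCommutativeRing = record
      { isRing = record
        { +-isAbelianGroup = record
          { isGroup = record
            { isMonoid = record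
              { isSemigroup = record
                { isMagma = record { isEquivalence = ≡.isEquivalence ; ∙-cong = cong₂ _⊞_ }
                ; assoc = λ { (a , b) (c , d) (e , f) → pair (+-assoc a c e) (+-assoc b d f) } }
              ; identity = (λ { (a , b) → pair (+-identity a) (+-identity b) })
                         , (λ { (a , b) → pair (≡.trans (+-comm a 0ℤ) (+-identity a)) (≡.trans (+-comm b 0ℤ) (+-identity b)) }) }
            ; inverse = (λ { (a , b) → pair (+-inverse a) (+-inverse b) })
                      , (λ { (a , b) → pair (≡.trans (+-comm a (- a)) (+-inverse a)) (≡.trans (+-comm b (- b)) (+-inverse b)) })
            ; ⁻¹-cong = cong ⊟_ }
          ; comm = λ { (a , b) (c , d) → pair (+-comm a c) (+-comm b d) } }
        ; *-cong = cong₂ _⊠_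
        ; *-assoc = λ { (a , b) (c , d) (e , f) → pair (⊠-assoc₁ A B a b c d e f) (⊠-assoc₂ A B a b c d e f) }
        ; *-identity = ⊠-identityˡ , (λ x → ≡.trans (⊠-comm x _) (⊠-identityˡ x))
        ; distrib = ⊠-distribˡ
                  , (λ x y z → ≡.trans (⊠-comm (y ⊞ z) x)
                      (≡.trans (⊠-distribˡ x y z) (cong₂ _⊞_ (⊠-comm x y) (⊠-comm x z)))) }
      ; *-comm = ⊠-comm } }

  module Modulo (p : ℕ) where
    open IntegersModulo p

    infix 4 _≈ᵅ_
    record _≈ᵅ_ (x y : ℤ[α]) : Set where
      constructor _,_
      field
        fst≈ : proj₁ x ≈ proj₁ y
        snd≈ : proj₂ x ≈ proj₂ y
    open _≈ᵅ_ public

    ℤ[α]ₚ : CommutativeRing 0ℓ 0ℓ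
    ℤ[α]ₚ = coarsenRing ring _≈ᵅ_
      (record { refl  = ≈-refl , ≈-refl
              ; sym   = λ (a , b) → ≈-sym a , ≈-sym b
              ; trans = λ (a , b) (c , d) → ≈-trans a c , ≈-trans b d })
      (λ { refl → ≈-refl , ≈-refl })
      (λ (a , b) (c , d) → +-cong a c , +-cong b d)
      (λ (a , b) (c , d) → +-cong (*-cong a c) (-‿cong (*-cong (*-cong (≈-refl {B}) b) d))
                         , +-cong (+-cong (*-cong a d) (*-cong b c)) (*-cong (*-cong (≈-refl {A}) b) d))
      (λ (a , b) → -‿cong a , -‿cong b)

module OddPrimeExtension (A B : ℤ) (p n : ℕ) (pr : Prime p) (p≡2n+1 : p ≡ suc (2 ℕ.* n)) where
  open OddPrimeModulus p n pr p≡2n+1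
  open QuadraticExtension A B
  open Modulo p public
  open LucasSequences A B
  module Rᵅ = CommutativeRing ℤ[α]ₚ
  module Σᵅ = RingSums ℤ[α]ₚ
  open Σᵅ public using () renaming (_^_ to _^ᵅ_)
  open import Relation.Binary.Reasoning.Setoid Rᵅ.setoid

  ι : ℤ → ℤ[α]
  ι a = (a , 0ℤ)

  α : ℤ[α]
  α = (0ℤ , 1ℤ)

  ι-cong : ∀ {a b} → a ≈ b → ι a ≈ᵅ ι b
  ι-cong a≈b = a≈b , ≈-refl

  ι⊠ : ∀ a x y → ι a ⊠ (x , y) ≡ (a * x , a * y)
  ι⊠ a x y = cong₂ _,_ (scale₁ B a x y) (scale₂ A a x y)
    where
    scale₁ : ∀ B a x y → a * x - B * 0ℤ * y ≡ a * x
    scale₁ = solve-∀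
    scale₂ : ∀ A a x y → a * y + 0ℤ * x + A * 0ℤ * y ≡ a * y
    scale₂ = solve-∀

  ι-* : ∀ a b → ι (a * b) ≡ ι a ⊠ ι b
  ι-* a b = ≡.sym (≡.trans (ι⊠ a b 0ℤ) (cong (a * b ,_) (ℤP.*-zeroʳ a)))

  ι-^ : ∀ a k → ι a ^ᵅ k ≡ ι (a ^ k)
  ι-^ a zero    = refl
  ι-^ a (suc k) = ≡.trans (cong (ι a ⊠_) (ι-^ a k)) (≡.sym (ι-* a (a ^ k)))

  Σᵅ-components : ∀ k (F : ℕ → ℤ[α]) → Σᵅ.Σ k F ≡ (Σ k (λ j → proj₁ (F j)) , Σ k (λ j → proj₂ (F j)))
  Σᵅ-components zero    F = refl
  Σᵅ-components (suc k) F = cong (F 0 ⊞_) (Σᵅ-components k (λ j → F (suc j)))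

  α^k≡κ+uα : ∀ k → α ^ᵅ k ≡ (κ k , u A B k)
  α^k≡κ+uα zero    = refl
  α^k≡κ+uα (suc k) = ≡.trans (cong (α ⊠_) (α^k≡κ+uα k))
    (cong₂ _,_ (shift₁ B (κ k) (u A B k)) (≡.trans (shift₂ A (κ k) (u A B k)) (≡.sym (u-suc k))))
    where
    shift₁ : ∀ B x y → 0ℤ * x - B * 1ℤ * y ≡ - B * y
    shift₁ = solve-∀
    shift₂ : ∀ A x y → 0ℤ * y + 1ℤ * x + A * 1ℤ * y ≡ x + A * y
    shift₂ = solve-∀

  ·≈ι⊠ : ∀ k x → k Σᵅ.· x ≈ᵅ ι (+ k) ⊠ x
  ·≈ι⊠ zero    x = Rᵅ.sym (Rᵅ.zeroˡ x)
  ·≈ι⊠ (suc k) x = begin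
    x ⊞ k Σᵅ.· x               ≈⟨ Rᵅ.+-congˡ {x} (·≈ι⊠ k x) ⟩
    x ⊞ ι (+ k) ⊠ x            ≈⟨ Rᵅ.+-congʳ {ι (+ k) ⊠ x} (Rᵅ.*-identityˡ x) ⟨
    ι 1ℤ ⊠ x ⊞ ι (+ k) ⊠ x     ≈⟨ Rᵅ.distribʳ x (ι 1ℤ) (ι (+ k)) ⟨
    ι (1ℤ + + k) ⊠ x           ∎

  [1+aα]^j≈Σ : ∀ a j → (1ℤ , a) ^ᵅ j ≈ᵅ Σᵅ.Σ (suc j) (λ k → ι (+ (j C k) * a ^ k) ⊠ α ^ᵅ k)
  [1+aα]^j≈Σ a j = begin
    (1ℤ , a) ^ᵅ j                                              ≡⟨ cong (_^ᵅ j) aα+1≡1+aα ⟨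
    (aα ⊞ ι 1ℤ) ^ᵅ j                                           ≈⟨ Σᵅ.binomial-theorem j aα (ι 1ℤ) ⟩
    Σᵅ.Σ (suc j) (λ k → (j C k) Σᵅ.· (aα ^ᵅ k ⊠ ι 1ℤ ^ᵅ (j ∸ k))) ≈⟨ Σᵅ.Σ-cong (suc j) (λ k _ → binomial-term k) ⟩
    Σᵅ.Σ (suc j) (λ k → ι (+ (j C k) * a ^ k) ⊠ α ^ᵅ k)        ∎
    where
    aα = ι a ⊠ α
    aα+1≡1+aα : aα ⊞ ι 1ℤ ≡ (1ℤ , a)
    aα+1≡1+aα = cong₂ _,_ (first B a) (second A a)
      where
      first : ∀ B a → (a * 0ℤ - B * 0ℤ * 1ℤ) + 1ℤ ≡ 1ℤ
      first = solve-∀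
      second : ∀ A a → (a * 1ℤ + 0ℤ * 0ℤ + A * 0ℤ * 1ℤ) + 0ℤ ≡ a
      second = solve-∀
    binomial-term : ∀ k → (j C k) Σᵅ.· (aα ^ᵅ k ⊠ ι 1ℤ ^ᵅ (j ∸ k)) ≈ᵅ ι (+ (j C k) * a ^ k) ⊠ α ^ᵅ k
    binomial-term k = begin
      (j C k) Σᵅ.· (aα ^ᵅ k ⊠ ι 1ℤ ^ᵅ (j ∸ k))  ≈⟨ ·≈ι⊠ (j C k) _ ⟩
      ι c ⊠ (aα ^ᵅ k ⊠ ι 1ℤ ^ᵅ (j ∸ k))          ≈⟨ Rᵅ.*-congˡ {ι c} (Rᵅ.*-congˡ {aα ^ᵅ k} 1^≈1) ⟩
      ι c ⊠ (aα ^ᵅ k ⊠ ι 1ℤ)                      ≈⟨ Rᵅ.*-congˡ {ι c} (Rᵅ.*-identityʳ (aα ^ᵅ k)) ⟩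
      ι c ⊠ aα ^ᵅ k                               ≈⟨ Rᵅ.*-congˡ {ι c} (Σᵅ.^-distrib-* (ι a) α k) ⟩
      ι c ⊠ (ι a ^ᵅ k ⊠ α ^ᵅ k)                   ≡⟨ cong (λ y → ι c ⊠ (y ⊠ α ^ᵅ k)) (ι-^ a k) ⟩
      ι c ⊠ (ι (a ^ k) ⊠ α ^ᵅ k)                  ≈⟨ Rᵅ.*-assoc (ι c) (ι (a ^ k)) (α ^ᵅ k) ⟨
      ι c ⊠ ι (a ^ k) ⊠ α ^ᵅ k                    ≡⟨ cong (_⊠ α ^ᵅ k) (ι-* c (a ^ k)) ⟨
      ι (c * a ^ k) ⊠ α ^ᵅ k                      ∎
      where
      c = + (j C k)
      1^≈1 : ι 1ℤ ^ᵅ (j ∸ k) ≈ᵅ ι 1ℤ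
      1^≈1 = Rᵅ.trans (Rᵅ.reflexive (ι-^ 1ℤ (j ∸ k))) (ι-cong (1^n≈1 (j ∸ k)))

  frobenius : ∀ x y → (x ⊞ y) ^ᵅ p ≈ᵅ x ^ᵅ p ⊞ y ^ᵅ p
  frobenius = Σᵅ.freshman's-dream pr (Rᵅ.trans (·≈ι⊠ p (ι 1ℤ)) (Rᵅ.trans (Rᵅ.reflexive (≡.sym (ι-* (+ p) 1ℤ)))
    (ι-cong (≈-trans (≈-reflexive (ℤP.*-identityʳ (+ p))) p≈0))))

  ι-fermat : ∀ a → ι a ^ᵅ p ≈ᵅ ι a
  ι-fermat a = Rᵅ.trans (Rᵅ.reflexive (ι-^ a p)) (ι-cong (fermat a))

  ^ᵅ-odd : ∀ x → x ^ᵅ p ≈ᵅ x ⊠ (x ⊠ x) ^ᵅ n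
  ^ᵅ-odd x = Rᵅ.trans (Rᵅ.reflexive (cong (x ^ᵅ_) p≡2n+1)) (Σᵅ.^-odd x n)

  cancel-ι : ∀ {c x y} → ¬ (+ p ∣ c) → ι c ⊠ x ≈ᵅ ι c ⊠ y → x ≈ᵅ y
  cancel-ι {c} {x₁ , x₂} {y₁ , y₂} p∤c cx≈cy with Rᵅ.trans (Rᵅ.reflexive (≡.sym (ι⊠ c x₁ x₂))) (Rᵅ.trans cx≈cy (Rᵅ.reflexive (ι⊠ c y₁ y₂)))
  ... | cx₁≈cy₁ , cx₂≈cy₂ = cancel p∤c cx₁≈cy₁ , cancel p∤c cx₂≈cy₂

  -- r = 2α - A satisfies r² = Δ, hence r^p = r Δ^n = (Δ/p) r by Euler's criterion.
  2α^p≈ : ∀ {ℓ} → legendre (A * A - + 4 * B) p ≡ ℓ → ι (+ 2) ⊠ α ^ᵅ p ≈ᵅ (A - A * ℓ , + 2 * ℓ)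
  2α^p≈ {ℓ} Δ/p≡ℓ = begin
    ι (+ 2) ⊠ α ^ᵅ p             ≈⟨ Rᵅ.*-congʳ {α ^ᵅ p} (ι-fermat (+ 2)) ⟨
    ι (+ 2) ^ᵅ p ⊠ α ^ᵅ p        ≈⟨ Σᵅ.^-distrib-* (ι (+ 2)) α p ⟨
    (ι (+ 2) ⊠ α) ^ᵅ p           ≡⟨ cong (_^ᵅ p) (cong₂ _,_ (two-α₁ A B) (two-α₂ A)) ⟩
    (ι A ⊞ r) ^ᵅ p               ≈⟨ frobenius (ι A) r ⟩
    ι A ^ᵅ p ⊞ r ^ᵅ p            ≈⟨ Rᵅ.+-cong (ι-fermat A) (^ᵅ-odd r) ⟩
    ι A ⊞ r ⊠ (r ⊠ r) ^ᵅ n       ≡⟨ cong (λ z → ι A ⊞ r ⊠ z ^ᵅ n) (cong₂ _,_ (r²₁ A B) (r²₂ A)) ⟩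
    ι A ⊞ r ⊠ ι Δ ^ᵅ n           ≡⟨ cong (λ z → ι A ⊞ r ⊠ z) (ι-^ Δ n) ⟩
    ι A ⊞ r ⊠ ι (Δ ^ n)          ≈⟨ Rᵅ.+-congˡ {ι A} (Rᵅ.*-congˡ {r} (ι-cong (≈-trans (≈-sym (euler-criterion Δ)) (≈-reflexive Δ/p≡ℓ)))) ⟩
    ι A ⊞ r ⊠ ι ℓ                ≡⟨ cong₂ _,_ (result₁ A B ℓ) (result₂ A ℓ) ⟩
    (A - A * ℓ , + 2 * ℓ)        ∎
    where
    Δ = A * A - + 4 * B
    r = (- A , + 2)
    two-α₁ : ∀ A B → + 2 * 0ℤ - B * 0ℤ * 1ℤ ≡ A + - A
    two-α₁ = solve-∀
    two-α₂ : ∀ A → + 2 * 1ℤ + 0ℤ * 0ℤ + A * 0ℤ * 1ℤ ≡ 0ℤ + + 2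
    two-α₂ = solve-∀
    r²₁ : ∀ A B → - A * - A - B * + 2 * + 2 ≡ A * A - + 4 * B
    r²₁ = solve-∀
    r²₂ : ∀ A → - A * + 2 + + 2 * - A + A * + 2 * + 2 ≡ 0ℤ
    r²₂ = solve-∀
    result₁ : ∀ A B ℓ → A + (- A * ℓ - B * + 2 * 0ℤ) ≡ A - A * ℓ
    result₁ = solve-∀
    result₂ : ∀ A ℓ → 0ℤ + (- A * 0ℤ + + 2 * ℓ + A * + 2 * 0ℤ) ≡ + 2 * ℓ
    result₂ = solve-∀

  α^p≈α : legendre (A * A - + 4 * B) p ≡ 1ℤ → α ^ᵅ p ≈ᵅ α
  α^p≈α Δ/p≡1 = cancel-ι p∤2 (Rᵅ.trans (2α^p≈ Δ/p≡1) (Rᵅ.reflexive (≡.sym (≡.trans (ι⊠ (+ 2) 0ℤ 1ℤ) (cong₂ _,_ (two-α₁ A) refl)))))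
    where
    two-α₁ : ∀ A → + 2 * 0ℤ ≡ A - A * 1ℤ
    two-α₁ = solve-∀

  α^p≈ᾱ : legendre (A * A - + 4 * B) p ≡ -1ℤ → α ^ᵅ p ≈ᵅ (A , -1ℤ)
  α^p≈ᾱ Δ/p≡-1 = cancel-ι p∤2 (Rᵅ.trans (2α^p≈ Δ/p≡-1) (Rᵅ.reflexive (≡.sym (≡.trans (ι⊠ (+ 2) A -1ℤ) (cong₂ _,_ (two-ᾱ₁ A) refl)))))
    where
    two-ᾱ₁ : ∀ A → + 2 * A ≡ A - A * -1ℤ
    two-ᾱ₁ = solve-∀

module LucasBinomialSums (A B m d : ℤ) (p n : ℕ) (pr : Prime p) (p≡2n+1 : p ≡ suc (2 ℕ.* n))
  (p∤m : ¬ (+ p Signed.∣ m)) (p∤Δ : ¬ (+ p Signed.∣ A * A - + 4 * B))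
  (p∣d²-N : + p Signed.∣ d * d - (m * m - + 4 * A * m + + 16 * B))
  (p∤N : ¬ (+ p Signed.∣ m * m - + 4 * A * m + + 16 * B)) where

  open OddPrimeModulus p n pr p≡2n+1
  open QuadraticExtension A B
  open OddPrimeExtension A B p n pr p≡2n+1
  open LucasSequences A B
  open FractionSums p
  module ≈-Reasoning = Relation.Binary.Reasoning.Setoid (CommutativeRing.setoid ℤₚ)
  module ≈ᵅ-Reasoning = Relation.Binary.Reasoning.Setoid Rᵅ.setoid

  Δ N t ν ε : ℤ
  Δ = A * A - + 4 * B
  N = m * m - + 4 * A * m + + 16 * B
  t = m - d - + 2 * A
  ν = - + 2 * d * t
  ε = legendre (+ 2 * m) p * legendre t p

  d²≈N : d * d ≈ N
  d²≈N = mk p∣d²-N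

  p∤d : ¬ (+ p ∣ d)
  p∤d p∣d = p∤N (≈0⇒∣ (≈-trans (≈-sym d²≈N) (∣⇒≈0 (Signed.∣m⇒∣m*n d p∣d))))

  -- t (m - 2A + d) = (m - 2A)² - d² ≡ (m - 2A)² - N = 4Δ.
  p∤t : ¬ (+ p ∣ t)
  p∤t p∣t = ∤-* p∤2 (∤-* p∤2 p∤Δ) (≈0⇒∣ (begin
    + 2 * (+ 2 * Δ)                     ≡⟨ four-Δ m A B ⟨
    (m - + 2 * A) * (m - + 2 * A) - N   ≈⟨ +-cong (≈-refl {(m - + 2 * A) * (m - + 2 * A)}) (-‿cong (≈-sym d²≈N)) ⟩
    (m - + 2 * A) * (m - + 2 * A) - d * d ≡⟨ difference-of-squares m d A ⟨
    t * (m - + 2 * A + d)               ≈⟨ ∣⇒≈0 (Signed.∣m⇒∣m*n (m - + 2 * A + d) p∣t) ⟩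
    0ℤ                                  ∎))
    where
    open ≈-Reasoning
    four-Δ : ∀ m A B → (m - + 2 * A) * (m - + 2 * A) - (m * m - + 4 * A * m + + 16 * B) ≡ + 2 * (+ 2 * (A * A - + 4 * B))
    four-Δ = solve-∀
    difference-of-squares : ∀ m d A → (m - d - + 2 * A) * (m - + 2 * A + d) ≡ (m - + 2 * A) * (m - + 2 * A) - d * d
    difference-of-squares = solve-∀

  ε≈[2mt]^n : ε ≈ (+ 2 * m * t) ^ n
  ε≈[2mt]^n = ≈-trans (*-cong (euler-criterion (+ 2 * m)) (euler-criterion t)) (≈-sym (^-distrib-* (+ 2 * m) t n))

  ε²≈1 : ε * ε ≈ 1ℤ
  ε²≈1 = begin
    ε * ε                            ≈⟨ *-cong ε≈[2mt]^n ε≈[2mt]^n ⟩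
    (+ 2 * m * t) ^ n * (+ 2 * m * t) ^ n ≈⟨ ^-distrib-* (+ 2 * m * t) (+ 2 * m * t) n ⟨
    (+ 2 * m * t * (+ 2 * m * t)) ^ n ≈⟨ square^n≈1 (∤-* (∤-* p∤2 p∤m) p∤t) ⟩
    1ℤ                               ∎
    where open ≈-Reasoning

  p∤ε : ¬ (+ p ∣ ε)
  p∤ε p∣ε = 1≉0 (≈-trans (≈-sym ε²≈1) (∣⇒≈0 (Signed.∣m⇒∣m*n ε p∣ε)))

  p∤ν : ¬ (+ p ∣ ν)
  p∤ν = ∤-* { - + 2 * d} (∤-* { - + 2} p∤-2 p∤d) p∤t

  μ : ℤ
  μ = m ⁻¹

  C₂ : ℕ → ℤ
  C₂ k = + ((2 ℕ.* k) C k)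

  -- Modulo p, 1/m^k is μ^k, so the Lucas sums reduce to these integer sums.
  S : (ℕ → ℤ) → ℤ
  S w = Σ p (λ k → w k * C₂ k * μ ^ k)

  T : ℤ[α]
  T = Σᵅ.Σ p (λ k → ι (C₂ k * μ ^ k) ⊠ α ^ᵅ k)

  central-binomial≈μ : ∀ {k} → k < p → C₂ k * μ ^ k ≈ + (n C k) * (- + 4 * μ) ^ k
  central-binomial≈μ {k} k<p = begin
    C₂ k * μ ^ k                            ≈⟨ *-cong (central-binomial≈ k<p) (≈-refl {μ ^ k}) ⟩
    (- + 4) ^ k * + (n C k) * μ ^ k         ≡⟨ swap ((- + 4) ^ k) (+ (n C k)) (μ ^ k) ⟩
    + (n C k) * ((- + 4) ^ k * μ ^ k)       ≈⟨ *-cong (≈-refl {+ (n C k)}) (^-distrib-* (- + 4) μ k) ⟨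
    + (n C k) * (- + 4 * μ) ^ k             ∎
    where
    open ≈-Reasoning
    swap : ∀ a b c → a * b * c ≡ b * (a * c)
    swap = solve-∀

  -- C(n, k) = 0 for k > n, so what remains of T is the binomial expansion of (1 - 4μα)ⁿ.
  T≈[1-4μα]^n : T ≈ᵅ (1ℤ , - + 4 * μ) ^ᵅ n
  T≈[1-4μα]^n = begin
    T                                                      ≈⟨ Σᵅ.Σ-cong p (λ k k<p → Rᵅ.*-congʳ {α ^ᵅ k} (ι-cong (central-binomial≈μ k<p))) ⟩
    Σᵅ.Σ p term                                            ≡⟨ cong (λ q → Σᵅ.Σ q term) p≡[n+1]+n ⟩
    Σᵅ.Σ (suc n ℕ.+ n) term                                ≈⟨ Σᵅ.Σ-split (suc n) n term ⟩
    Σᵅ.Σ (suc n) term ⊞ Σᵅ.Σ n (λ k → term (suc n ℕ.+ k))  ≈⟨ Rᵅ.+-congˡ {Σᵅ.Σ (suc n) term} (Σᵅ.Σ-≈0 n (λ k _ → vanishing-term k)) ⟩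
    Σᵅ.Σ (suc n) term ⊞ (0ℤ , 0ℤ)                          ≈⟨ Rᵅ.+-identityʳ _ ⟩
    Σᵅ.Σ (suc n) term                                      ≈⟨ [1+aα]^j≈Σ (- + 4 * μ) n ⟨
    (1ℤ , - + 4 * μ) ^ᵅ n                                  ∎
    where
    open ≈ᵅ-Reasoning
    term : ℕ → ℤ[α]
    term k = ι (+ (n C k) * (- + 4 * μ) ^ k) ⊠ α ^ᵅ k
    p≡[n+1]+n : p ≡ suc n ℕ.+ n
    p≡[n+1]+n = ≡.trans p≡2n+1 (cong (λ k → suc (n ℕ.+ k)) (ℕP.+-identityʳ n))
    vanishing-term : ∀ k → term (suc n ℕ.+ k) ≈ᵅ (0ℤ , 0ℤ)
    vanishing-term k = Rᵅ.trans
      (Rᵅ.reflexive (cong (λ c → ι (+ c * (- + 4 * μ) ^ (suc n ℕ.+ k)) ⊠ α ^ᵅ (suc n ℕ.+ k))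
        (k>n⇒nCk≡0 {n} {suc n ℕ.+ k} (s≤s (ℕP.m≤m+n n k)))))
      (Rᵅ.zeroˡ (α ^ᵅ (suc n ℕ.+ k)))

  w w̄ : ℤ[α]
  w = (m - d , - + 4)
  w̄ = (m - d - + 4 * A , + 4)

  w⊠w̄≈ν : w ⊠ w̄ ≈ᵅ ι ν
  w⊠w̄≈ν = first , ≈-reflexive (second A m d)
    where
    open ≈-Reasoning
    expand : ∀ A B m d → (m - d) * (m - d - + 4 * A) - B * - + 4 * + 4
                       ≡ - + 2 * d * (m - d - + 2 * A) + ((m * m - + 4 * A * m + + 16 * B) - d * d)
    expand = solve-∀
    second : ∀ A m d → (m - d) * + 4 + - + 4 * (m - d - + 4 * A) + A * - + 4 * + 4 ≡ 0ℤ
    second = solve-∀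
    first : proj₁ (w ⊠ w̄) ≈ ν
    first = begin
      proj₁ (w ⊠ w̄)   ≡⟨ expand A B m d ⟩
      ν + (N - d * d)  ≈⟨ +-cong (≈-refl {ν}) (∣⇒≈0 (get (≈-sym d²≈N))) ⟩
      ν + 0ℤ           ≡⟨ ℤP.+-identityʳ ν ⟩
      ν                ∎

  w⊠w≈2mt⊠[1-4μα] : w ⊠ w ≈ᵅ ι (+ 2 * m * t) ⊠ (1ℤ , - + 4 * μ)
  w⊠w≈2mt⊠[1-4μα] = Rᵅ.trans (first , second) (Rᵅ.reflexive (≡.sym (ι⊠ (+ 2 * m * t) 1ℤ (- + 4 * μ))))
    where
    open ≈-Reasoning
    expand₁ : ∀ A B m d → (m - d) * (m - d) - B * - + 4 * - + 4
                        ≡ + 2 * m * (m - d - + 2 * A) * 1ℤ + (d * d - (m * m - + 4 * A * m + + 16 * B))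
    expand₁ = solve-∀
    expand₂ : ∀ A m d → (m - d) * - + 4 + - + 4 * (m - d) + A * - + 4 * - + 4 ≡ - + 8 * (m - d - + 2 * A) * 1ℤ
    expand₂ = solve-∀
    regroup : ∀ m t μ → - + 8 * t * (m * μ) ≡ + 2 * m * t * (- + 4 * μ)
    regroup = solve-∀
    first : proj₁ (w ⊠ w) ≈ + 2 * m * t * 1ℤ
    first = begin
      proj₁ (w ⊠ w)                            ≡⟨ expand₁ A B m d ⟩
      + 2 * m * t * 1ℤ + (d * d - N)           ≈⟨ +-cong (≈-refl {+ 2 * m * t * 1ℤ}) (∣⇒≈0 p∣d²-N) ⟩
      + 2 * m * t * 1ℤ + 0ℤ                    ≡⟨ ℤP.+-identityʳ _ ⟩
      + 2 * m * t * 1ℤ                         ∎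
    second : proj₂ (w ⊠ w) ≈ + 2 * m * t * (- + 4 * μ)
    second = begin
      proj₂ (w ⊠ w)                  ≡⟨ expand₂ A m d ⟩
      - + 8 * t * 1ℤ                 ≈⟨ *-cong (≈-refl { - + 8 * t}) (*-inverseʳ p∤m) ⟨
      - + 8 * t * (m * μ)            ≡⟨ regroup m t μ ⟩
      + 2 * m * t * (- + 4 * μ)      ∎

  w^p≈ε⊠w⊠T : w ^ᵅ p ≈ᵅ ι ε ⊠ (w ⊠ T)
  w^p≈ε⊠w⊠T = begin
    w ^ᵅ p                                          ≈⟨ ^ᵅ-odd w ⟩
    w ⊠ (w ⊠ w) ^ᵅ n                                ≈⟨ Rᵅ.*-congˡ {w} (Σᵅ.^-congˡ n w⊠w≈2mt⊠[1-4μα]) ⟩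
    w ⊠ (ι (+ 2 * m * t) ⊠ z) ^ᵅ n                  ≈⟨ Rᵅ.*-congˡ {w} (Σᵅ.^-distrib-* (ι (+ 2 * m * t)) z n) ⟩
    w ⊠ (ι (+ 2 * m * t) ^ᵅ n ⊠ z ^ᵅ n)             ≡⟨ cong (λ y → w ⊠ (y ⊠ z ^ᵅ n)) (ι-^ (+ 2 * m * t) n) ⟩
    w ⊠ (ι ((+ 2 * m * t) ^ n) ⊠ z ^ᵅ n)            ≈⟨ Rᵅ.*-congˡ {w} (Rᵅ.*-cong (ι-cong (≈-sym ε≈[2mt]^n)) (Rᵅ.sym T≈[1-4μα]^n)) ⟩
    w ⊠ (ι ε ⊠ T)                                   ≈⟨ x∙yz≈y∙xz w (ι ε) T ⟩
    ι ε ⊠ (w ⊠ T)                                   ∎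
    where
    open ≈ᵅ-Reasoning
    open import Algebra.Properties.CommutativeSemigroup Rᵅ.*-commutativeSemigroup using (x∙yz≈y∙xz)
    z = (1ℤ , - + 4 * μ)

  w≡m-d-4α : w ≡ ι (m - d) ⊞ ι (- + 4) ⊠ α
  w≡m-d-4α = ≡.sym (cong₂ _,_ (first A B m d) (second A))
    where
    first : ∀ A B m d → m - d + (- + 4 * 0ℤ - B * 0ℤ * 1ℤ) ≡ m - d
    first = solve-∀
    second : ∀ A → 0ℤ + (- + 4 * 1ℤ + 0ℤ * 0ℤ + A * 0ℤ * 1ℤ) ≡ - + 4
    second = solve-∀

  -- Both sides equal w^p w̄: the left via w^p = ε w T and w w̄ = ν, the right by Frobenius.
  εν⊠T≈[m-d-4α^p]⊠w̄ : ι (ε * ν) ⊠ T ≈ᵅ (ι (m - d) ⊞ ι (- + 4) ⊠ α ^ᵅ p) ⊠ w̄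
  εν⊠T≈[m-d-4α^p]⊠w̄ = Rᵅ.sym (begin
    (ι (m - d) ⊞ ι (- + 4) ⊠ α ^ᵅ p) ⊠ w̄  ≈⟨ Rᵅ.*-congʳ {w̄} w^p≈m-d-4α^p ⟨
    w ^ᵅ p ⊠ w̄                            ≈⟨ Rᵅ.*-congʳ {w̄} w^p≈ε⊠w⊠T ⟩
    ι ε ⊠ (w ⊠ T) ⊠ w̄                     ≈⟨ Rᵅ.*-assoc (ι ε) (w ⊠ T) w̄ ⟩
    ι ε ⊠ (w ⊠ T ⊠ w̄)                     ≈⟨ Rᵅ.*-congˡ {ι ε} (xy∙z≈xz∙y w T w̄) ⟩
    ι ε ⊠ (w ⊠ w̄ ⊠ T)                     ≈⟨ Rᵅ.*-congˡ {ι ε} (Rᵅ.*-congʳ {T} w⊠w̄≈ν) ⟩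
    ι ε ⊠ (ι ν ⊠ T)                       ≈⟨ Rᵅ.*-assoc (ι ε) (ι ν) T ⟨
    ι ε ⊠ ι ν ⊠ T                         ≡⟨ cong (_⊠ T) (ι-* ε ν) ⟨
    ι (ε * ν) ⊠ T                         ∎)
    where
    open ≈ᵅ-Reasoning
    open import Algebra.Properties.CommutativeSemigroup Rᵅ.*-commutativeSemigroup using (xy∙z≈xz∙y)
    w^p≈m-d-4α^p : w ^ᵅ p ≈ᵅ ι (m - d) ⊞ ι (- + 4) ⊠ α ^ᵅ p
    w^p≈m-d-4α^p = begin
      w ^ᵅ p                                    ≡⟨ cong (_^ᵅ p) w≡m-d-4α ⟩
      (ι (m - d) ⊞ ι (- + 4) ⊠ α) ^ᵅ p          ≈⟨ frobenius (ι (m - d)) (ι (- + 4) ⊠ α) ⟩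
      ι (m - d) ^ᵅ p ⊞ (ι (- + 4) ⊠ α) ^ᵅ p     ≈⟨ Rᵅ.+-cong (ι-fermat (m - d)) (Σᵅ.^-distrib-* (ι (- + 4)) α p) ⟩
      ι (m - d) ⊞ ι (- + 4) ^ᵅ p ⊠ α ^ᵅ p       ≈⟨ Rᵅ.+-congˡ {ι (m - d)} (Rᵅ.*-congʳ {α ^ᵅ p} (ι-fermat (- + 4))) ⟩
      ι (m - d) ⊞ ι (- + 4) ⊠ α ^ᵅ p            ∎

  p∤εν : ¬ (+ p ∣ ε * ν)
  p∤εν = ∤-* p∤ε p∤ν

  T≈ε : legendre Δ p ≡ 1ℤ → T ≈ᵅ ι ε
  T≈ε Δ/p≡1 = cancel-ι p∤εν (begin
    ι (ε * ν) ⊠ T                          ≈⟨ εν⊠T≈[m-d-4α^p]⊠w̄ ⟩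
    (ι (m - d) ⊞ ι (- + 4) ⊠ α ^ᵅ p) ⊠ w̄  ≈⟨ Rᵅ.*-congʳ {w̄} (Rᵅ.+-congˡ {ι (m - d)} (Rᵅ.*-congˡ {ι (- + 4)} (α^p≈α Δ/p≡1))) ⟩
    (ι (m - d) ⊞ ι (- + 4) ⊠ α) ⊠ w̄       ≡⟨ cong (_⊠ w̄) w≡m-d-4α ⟨
    w ⊠ w̄                                 ≈⟨ w⊠w̄≈ν ⟩
    ι ν                                    ≈⟨ ι-cong ν≈ενε ⟩
    ι (ε * ν * ε)                          ≡⟨ ι-* (ε * ν) ε ⟩
    ι (ε * ν) ⊠ ι ε                        ∎)
    where
    open ≈ᵅ-Reasoning
    regroup : ∀ ε ν → ν * (ε * ε) ≡ ε * ν * ε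
    regroup = solve-∀
    ν≈ενε : ν ≈ ε * ν * ε
    ν≈ενε = ≈-trans (≈-reflexive (≡.sym (ℤP.*-identityʳ ν)))
              (≈-trans (*-cong (≈-refl {ν}) (≈-sym ε²≈1)) (≈-reflexive (regroup ε ν)))

  εν⊠T≈w̄² : legendre Δ p ≡ -1ℤ → ι (ε * ν) ⊠ T ≈ᵅ w̄ ⊠ w̄
  εν⊠T≈w̄² Δ/p≡-1 = begin
    ι (ε * ν) ⊠ T                          ≈⟨ εν⊠T≈[m-d-4α^p]⊠w̄ ⟩
    (ι (m - d) ⊞ ι (- + 4) ⊠ α ^ᵅ p) ⊠ w̄  ≈⟨ Rᵅ.*-congʳ {w̄} (Rᵅ.+-congˡ {ι (m - d)} (Rᵅ.*-congˡ {ι (- + 4)} (α^p≈ᾱ Δ/p≡-1))) ⟩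
    (ι (m - d) ⊞ ι (- + 4) ⊠ (A , -1ℤ)) ⊠ w̄ ≡⟨ cong (_⊠ w̄) (cong₂ _,_ (first A B m d) (second A)) ⟩
    w̄ ⊠ w̄                                 ∎
    where
    open ≈ᵅ-Reasoning
    first : ∀ A B m d → m - d + (- + 4 * A - B * 0ℤ * -1ℤ) ≡ m - d - + 4 * A
    first = solve-∀
    second : ∀ A → 0ℤ + (- + 4 * -1ℤ + 0ℤ * A + A * 0ℤ * -1ℤ) ≡ + 4
    second = solve-∀

  T-term≡ : ∀ k → ι (C₂ k * μ ^ k) ⊠ α ^ᵅ k ≡ (C₂ k * μ ^ k * κ k , C₂ k * μ ^ k * u A B k)
  T-term≡ k = ≡.trans (cong (ι (C₂ k * μ ^ k) ⊠_) (α^k≡κ+uα k)) (ι⊠ (C₂ k * μ ^ k) (κ k) (u A B k))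

  Σ-u≈T₂ : S (u A B) ≈ proj₂ T
  Σ-u≈T₂ = ≈-trans (Σ-cong p (λ k _ → ≈-reflexive (≡.trans (rotate (u A B k) (C₂ k) (μ ^ k)) (≡.sym (cong proj₂ (T-term≡ k))))))
             (≈-reflexive (≡.sym (cong proj₂ (Σᵅ-components p _))))
    where
    rotate : ∀ a b c → a * b * c ≡ b * c * a
    rotate = solve-∀

  Σ-v≈2T₁+AT₂ : S (v A B) ≈ + 2 * proj₁ T + A * proj₂ T
  Σ-v≈2T₁+AT₂ = begin
    S (v A B)                                           ≈⟨ Σ-cong p (λ k _ → ≈-reflexive (termwise k)) ⟩
    Σ p (λ k → + 2 * T₁-term k + A * T₂-term k)         ≈⟨ Σ-distrib-+ p _ _ ⟩
    Σ p (λ k → + 2 * T₁-term k) + Σ p (λ k → A * T₂-term k)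
      ≈⟨ +-cong (≈-sym (*-distribˡ-Σ p (+ 2) T₁-term)) (≈-sym (*-distribˡ-Σ p A T₂-term)) ⟩
    + 2 * Σ p T₁-term + A * Σ p T₂-term                 ≡⟨ cong₂ (λ x y → + 2 * x + A * y) (cong proj₁ T≡) (cong proj₂ T≡) ⟨
    + 2 * proj₁ T + A * proj₂ T                         ∎
    where
    open ≈-Reasoning
    T₁-term T₂-term : ℕ → ℤ
    T₁-term k = proj₁ (ι (C₂ k * μ ^ k) ⊠ α ^ᵅ k)
    T₂-term k = proj₂ (ι (C₂ k * μ ^ k) ⊠ α ^ᵅ k)
    T≡ : T ≡ (Σ p T₁-term , Σ p T₂-term)
    T≡ = Σᵅ-components p _
    distribute : ∀ A κ u c → (+ 2 * κ + A * u) * c ≡ + 2 * (c * κ) + A * (c * u)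
    distribute = solve-∀
    termwise : ∀ k → v A B k * C₂ k * μ ^ k ≡ + 2 * T₁-term k + A * T₂-term k
    termwise k = ≡.trans (ℤP.*-assoc (v A B k) (C₂ k) (μ ^ k))
      (≡.trans (cong (_* (C₂ k * μ ^ k)) (v≡2κ+Au k))
      (≡.trans (distribute A (κ k) (u A B k) (C₂ k * μ ^ k))
        (cong₂ (λ x y → + 2 * x + A * y) (≡.sym (cong proj₁ (T-term≡ k))) (≡.sym (cong proj₂ (T-term≡ k))))))

  lucasSum≈ : ∀ (w : ℕ → ℤ) → proj₁ (lucasSum w m p) ≈ proj₂ (lucasSum w m p) * S w
  lucasSum≈ w = numerator≈ p (λ k → w k * C₂ k) (m ℤ.^_) (μ ^_) m^kμ^k≈1
    where
    m^kμ^k≈1 : ∀ k → m ℤ.^ k * μ ^ k ≈ 1ℤ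
    m^kμ^k≈1 k = ≈-trans (≈-reflexive (cong (_* μ ^ k) (ℤ^≡^ m k)))
      (≈-trans (≈-sym (^-distrib-* m μ k)) (≈-trans (^-congˡ k (*-inverseʳ p∤m)) (1^n≈1 k)))

  sum-u-residue : legendre Δ p ≡ 1ℤ → lucasSum (u A B) m p ≡ (0ℤ , 1ℤ) [modQ p ]
  sum-u-residue Δ/p≡1 = ≡[modQ]-intro (lucasSum (u A B) m p) (lucasSum≈ (u A B))
    (≈-trans (≈-reflexive (ℤP.*-identityʳ _)) (≈-trans Σ-u≈T₂ (snd≈ (T≈ε Δ/p≡1))))

  sum-v-residue : legendre Δ p ≡ 1ℤ → lucasSum (v A B) m p ≡ (+ 2 * ε , 1ℤ) [modQ p ]
  sum-v-residue Δ/p≡1 = ≡[modQ]-intro (lucasSum (v A B) m p) (lucasSum≈ (v A B)) (begin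
    S (v A B) * 1ℤ                          ≡⟨ ℤP.*-identityʳ _ ⟩
    S (v A B)                               ≈⟨ Σ-v≈2T₁+AT₂ ⟩
    + 2 * proj₁ T + A * proj₂ T             ≈⟨ +-cong (*-cong (≈-refl {+ 2}) (fst≈ T≈)) (*-cong (≈-refl {A}) (snd≈ T≈)) ⟩
    + 2 * ε + A * 0ℤ                        ≡⟨ drop A ε ⟩
    + 2 * ε                                 ∎)
    where
    open ≈-Reasoning
    T≈ = T≈ε Δ/p≡1
    drop : ∀ A ε → + 2 * ε + A * 0ℤ ≡ + 2 * ε
    drop = solve-∀

  module _ (Δ/p≡-1 : legendre Δ p ≡ -1ℤ) where

    private
      εν⊠T≈ : (ε * ν * proj₁ T , ε * ν * proj₂ T) ≈ᵅ w̄ ⊠ w̄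
      εν⊠T≈ = Rᵅ.trans (Rᵅ.reflexive (≡.sym (ι⊠ (ε * ν) (proj₁ T) (proj₂ T)))) (εν⊠T≈w̄² Δ/p≡-1)

      -- q d = ε ν, so multiplying the claimed congruences by q turns them into statements about ε ν T.
      q : ℤ
      q = - + 2 * t * ε

      p∤q : ¬ (+ p ∣ q)
      p∤q = ∤-* { - + 2 * t} (∤-* { - + 2} p∤-2 p∤t) p∤ε

      x≈xε² : ∀ x → x ≈ x * (ε * ε)
      x≈xε² x = ≈-trans (≈-reflexive (≡.sym (ℤP.*-identityʳ x))) (*-cong (≈-refl {x}) (≈-sym ε²≈1))

    sum-u-nonresidue : lucasSum (u A B) m p ≡ (- (+ 4) * ε , d) [modQ p ]
    sum-u-nonresidue = ≡[modQ]-intro (lucasSum (u A B) m p) (lucasSum≈ (u A B)) (cancel p∤q (begin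
      q * (S (u A B) * d)  ≈⟨ *-cong (≈-refl {q}) (*-cong Σ-u≈T₂ (≈-refl {d})) ⟩
      q * (proj₂ T * d)    ≡⟨ regroup A m d ε (proj₂ T) ⟩
      ε * ν * proj₂ T      ≈⟨ snd≈ εν⊠T≈ ⟩
      proj₂ (w̄ ⊠ w̄)       ≡⟨ second A m d ⟩
      + 8 * t              ≈⟨ x≈xε² (+ 8 * t) ⟩
      + 8 * t * (ε * ε)    ≡⟨ result A m d ε ⟩
      q * (- (+ 4) * ε)    ∎))
      where
      open ≈-Reasoning
      regroup : ∀ A m d ε T₂ → - + 2 * (m - d - + 2 * A) * ε * (T₂ * d) ≡ ε * (- + 2 * d * (m - d - + 2 * A)) * T₂
      regroup = solve-∀
      second : ∀ A m d → (m - d - + 4 * A) * + 4 + + 4 * (m - d - + 4 * A) + A * + 4 * + 4 ≡ + 8 * (m - d - + 2 * A)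
      second = solve-∀
      result : ∀ A m d ε → + 8 * (m - d - + 2 * A) * (ε * ε) ≡ - + 2 * (m - d - + 2 * A) * ε * (- (+ 4) * ε)
      result = solve-∀

    sum-v-nonresidue : lucasSum (v A B) m p ≡ ((+ 4 * A - + 2 * m) * ε , d) [modQ p ]
    sum-v-nonresidue = ≡[modQ]-intro (lucasSum (v A B) m p) (lucasSum≈ (v A B)) (cancel p∤q (begin
      q * (S (v A B) * d)                              ≈⟨ *-cong (≈-refl {q}) (*-cong Σ-v≈2T₁+AT₂ (≈-refl {d})) ⟩
      q * ((+ 2 * proj₁ T + A * proj₂ T) * d)          ≡⟨ regroup A m d ε (proj₁ T) (proj₂ T) ⟩
      + 2 * (ε * ν * proj₁ T) + A * (ε * ν * proj₂ T)  ≈⟨ +-cong (*-cong (≈-refl {+ 2}) (fst≈ εν⊠T≈)) (*-cong (≈-refl {A}) (snd≈ εν⊠T≈)) ⟩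
      + 2 * proj₁ (w̄ ⊠ w̄) + A * proj₂ (w̄ ⊠ w̄)         ≡⟨ expand A B m d ⟩
      + 4 * t * (m - + 2 * A) + + 2 * (d * d - N)      ≈⟨ +-cong (≈-refl {+ 4 * t * (m - + 2 * A)}) (*-cong (≈-refl {+ 2}) (∣⇒≈0 p∣d²-N)) ⟩
      + 4 * t * (m - + 2 * A) + + 2 * 0ℤ               ≡⟨ drop (+ 4 * t * (m - + 2 * A)) ⟩
      + 4 * t * (m - + 2 * A)                          ≈⟨ x≈xε² (+ 4 * t * (m - + 2 * A)) ⟩
      + 4 * t * (m - + 2 * A) * (ε * ε)                ≡⟨ result A m d ε ⟩
      q * ((+ 4 * A - + 2 * m) * ε)                    ∎))
      where
      open ≈-Reasoning
      regroup : ∀ A m d ε T₁ T₂ → - + 2 * (m - d - + 2 * A) * ε * ((+ 2 * T₁ + A * T₂) * d)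
                                ≡ + 2 * (ε * (- + 2 * d * (m - d - + 2 * A)) * T₁) + A * (ε * (- + 2 * d * (m - d - + 2 * A)) * T₂)
      regroup = solve-∀
      expand : ∀ A B m d → + 2 * ((m - d - + 4 * A) * (m - d - + 4 * A) - B * + 4 * + 4)
                             + A * ((m - d - + 4 * A) * + 4 + + 4 * (m - d - + 4 * A) + A * + 4 * + 4)
                         ≡ + 4 * (m - d - + 2 * A) * (m - + 2 * A) + + 2 * (d * d - (m * m - + 4 * A * m + + 16 * B))
      expand = solve-∀
      drop : ∀ x → x + + 2 * 0ℤ ≡ x
      drop = solve-∀
      result : ∀ A m d ε → + 4 * (m - d - + 2 * A) * (m - + 2 * A) * (ε * ε)
                         ≡ - + 2 * (m - d - + 2 * A) * ε * ((+ 4 * A - + 2 * m) * ε)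
      result = solve-∀

even⊎odd : ∀ q → (Σ[ k ∈ ℕ ] q ≡ 2 ℕ.* k) ⊎ (Σ[ k ∈ ℕ ] q ≡ suc (2 ℕ.* k))
even⊎odd zero    = inj₁ (0 , ≡.refl)
even⊎odd (suc q) with even⊎odd q
... | inj₁ (k , q≡2k)   = inj₂ (k , ≡.cong suc q≡2k)
... | inj₂ (k , q≡2k+1) = inj₁ (suc k , ≡.trans (≡.cong suc q≡2k+1) (≡.sym (ℕP.*-distribˡ-+ 2 1 k)))

odd-prime : ∀ {p} → Prime p → p ≢ 2 → Σ[ n ∈ ℕ ] p ≡ suc (2 ℕ.* n)
odd-prime {p} pr p≢2 with even⊎odd p
... | inj₂ odd = odd
... | inj₁ (k , p≡2k) with prime⇒irreducible pr (ℕD.divides k (≡.trans p≡2k (ℕP.*-comm 2 k)))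
...   | inj₁ ()
...   | inj₂ 2≡p = ⊥-elim (p≢2 (≡.sym 2≡p))

open import Data.Integer.Divisibility using (_∣_)

theorem1p3 : (A B m d : ℤ) (p : ℕ) → Prime p → p ≢ 2 →
    ¬ ((+ p) ∣ m) →
    ¬ ((+ p) ∣ (A * A - + 4 * B)) →
    (+ p) ∣ (d * d - (m * m - + 4 * A * m + + 16 * B)) →
    ¬ ((+ p) ∣ (m * m - + 4 * A * m + + 16 * B)) →
    let Δ = A * A - + 4 * B
        ε = legendre (+ 2 * m) p * legendre (m - d - + 2 * A) p
    in (legendre Δ p ≡ 1ℤ →
          (lucasSum (u A B) m p ≡ (0ℤ , 1ℤ) [modQ p ])
          × (lucasSum (v A B) m p ≡ (+ 2 * ε , 1ℤ) [modQ p ]))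
       × (legendre Δ p ≡ - 1ℤ →
          (lucasSum (u A B) m p ≡ (- (+ 4) * ε , d) [modQ p ])
          × (lucasSum (v A B) m p ≡ ((+ 4 * A - + 2 * m) * ε , d) [modQ p ]))
theorem1p3 A B m d p pr p≢2 p∤m p∤Δ p∣d²-N p∤N with odd-prime pr p≢2
... | n , p≡2n+1 =
  (λ Δ/p≡1 → sum-u-residue Δ/p≡1 , sum-v-residue Δ/p≡1) ,
  (λ Δ/p≡-1 → sum-u-nonresidue Δ/p≡-1 , sum-v-nonresidue Δ/p≡-1)
  where
  open LucasBinomialSums A B m d p n pr p≡2n+1
    (p∤m ∘ Signed.∣⇒∣ᵤ) (p∤Δ ∘ Signed.∣⇒∣ᵤ) (Signed.∣ᵤ⇒∣ p∣d²-N) (p∤N ∘ Signed.∣⇒∣ᵤ)
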